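{- Let $D$ be a diagram of $[n]^2$ with columns $D_1,\dots,D_n$, and let $r_D(S)=\sum_{j=1}^n r_j(S)$ for $S\subseteq[n]$, where $r_j$ is the rank function of the Schubert matroid $SM_n(D_j)$. Then the vertex set of the Schubitope $\mathcal{S}_D$ is $\{x(w)\colon w\in S_n\}$, where for $w=w_1\cdots w_n\in S_n$, $x(w)=(x_1,\dots,x_n)\in\mathbb{R}^n$ is defined by \[x_{w_k}=r_D(\{w_1,\ldots,w_k\})-r_D(\{w_1,\ldots,w_{k-1}\}),\qquad 1\le k\le n.\]
   Context: A diagram $D$ of $[n]^2$ is a set of boxes $(i,j)$ of the $n\times n$ grid (row $i$, column $j$). Its $j$-th column is identified with the subset $D_j=\{i:(i,j)\in D\}\subseteq[n]$. For $S\subseteq[n]$, the Schubert matroid $SM_n(S)$ on ground set $[n]$ has bases the sets $T\subseteq[n]$ with $\#T=\#S$ such that, writing $T=\{a_1<\dots<a_k\}$, $S=\{b_1<\dots<b_k\}$, one has $a_i\le b_i$ for all $i$. The rank function of a matroid with bases $\mathcal{B}$ is $r(S)=\max\{\#(S\cap B): B\in\mathcal{B}\}$. The Schubitope: for $S\subseteq[n]$ and column $j$, let $\mathrm{word}_{j,S}(D)$ be obtained by reading column $j$ top to bottom, recording "(" if $(i,j)\notin D$, $i\in S$; ")" if $(i,j)\in D$, $i\notin S$; "$\star$" if $(i,j)\in D$, $i\in S$. Let $\theta_D(S)$ be the sum over $j$ of the number of matched "()" pairs (inside-out matching) plus the number of $\star$'s in $\mathrm{word}_{j,S}(D)$. Then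 $\mathcal{S}_D=\{x\in\mathbb{R}^n:\sum_i x_i=\#D,\ \sum_{i\in S}x_i\le\theta_D(S)\ \forall S\subsetneq[n]\}$.
   Formalization: The Schubitope $\mathcal{S}_D$ is taken in ℚ^n in place of $\mathbb{R}^n$, so its vertices are the extreme points among rational points. -}

module Defs where

open import Data.Bool using (Bool; true; false; _∧_; not; if_then_else_)
open import Data.Nat as ℕ using (ℕ; zero; suc; _⊔_; _<ᵇ_)
open import Data.Fin using (Fin; zero; suc; toℕ)
open import Data.Fin.Subset using (Subset; inside; outside; ∣_∣; _∩_; ⊤)
open import Data.Fin.Permutation using (Permutation′; _⟨$⟩ʳ_; _⟨$⟩ˡ_)
open import Data.List as List using (List; []; _∷_; filter; foldr)
import Data.Fin as F
open import Data.Vec as Vec using (Vec; []; _∷_; tabulate; lookup)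
open import Data.Integer as ℤ using (ℤ; +_)
open import Data.Rational as ℚ using (ℚ; _/_)
open import Data.Product using (_×_; ∃; ∃-syntax; Σ-syntax)
open import Relation.Binary.PropositionalEquality using (_≡_; _≢_)
open import Relation.Nullary using (¬_; does)

-- Diagrams: D i j = true  iff  the box (row i, column j) is in D.

Diagram : ℕ → Set
Diagram n = Fin n → Fin n → Bool

column : ∀ {n} → Diagram n → Fin n → Subset n
column D j = tabulate (λ i → D i j)

size : ∀ {n} → Diagram n → ℕ
size {n} D = ∑ℕ (λ j → ∣ column D j ∣)
  where
  ∑ℕ : (Fin n → ℕ) → ℕ
  ∑ℕ f = Vec.foldr _ ℕ._+_ 0 (tabulate f)

allSubsets : ∀ n → List (Subset n)
allSubsets zero    = [] ∷ []
allSubsets (suc n) =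
  List.map (inside ∷_) (allSubsets n) List.++ List.map (outside ∷_) (allSubsets n)

elements : ∀ {n} → Subset n → List (Fin n)
elements []             = []
elements (inside  ∷ p)  = zero ∷ List.map suc (elements p)
elements (outside ∷ p)  = List.map suc (elements p)

pointwiseLeq : ∀ {n} → List (Fin n) → List (Fin n) → Bool
pointwiseLeq []       []       = true
pointwiseLeq (a ∷ as) (b ∷ bs) = does (a F.≤? b) ∧ pointwiseLeq as bs
pointwiseLeq _        _        = false

isSchubertBasis : ∀ {n} → Subset n → Subset n → Bool
isSchubertBasis S T = does (∣ T ∣ ℕ.≟ ∣ S ∣) ∧ pointwiseLeq (elements T) (elements S)

schubertBases : ∀ {n} → Subset n → List (Subset n)
schubertBases {n} S = List.filterᵇ (isSchubertBasis S) (allSubsets n)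

schubertRank : ∀ {n} → Subset n → Subset n → ℕ
schubertRank S A = foldr (λ B m → ∣ A ∩ B ∣ ⊔ m) 0 (schubertBases S)

rankD : ∀ {n} → Diagram n → Subset n → ℕ
rankD {n} D A = Vec.foldr _ ℕ._+_ 0 (tabulate (λ j → schubertRank (column D j) A))

data Sym : Set where
  opn cls star : Sym

word : ∀ {n} → Diagram n → Fin n → Subset n → List Sym
word {n} D j S = go (List.allFin n)
  where
  go : List (Fin n) → List Sym
  go [] = []
  go (i ∷ is) with D i j | lookup S i
  ... | false | true  = opn ∷ go is
  ... | true  | false = cls ∷ go is
  ... | true  | true  = star ∷ go is
  ... | false | false = go is

matched : List Sym → ℕ
matched w = go w 0
  where
  go : List Sym → ℕ → ℕ
  go []          k       = 0
  go (opn ∷ w)   k       = go w (suc k)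
  go (cls ∷ w)   zero    = go w zero
  go (cls ∷ w)   (suc k) = suc (go w k)
  go (star ∷ w)  k       = go w k

stars : List Sym → ℕ
stars []          = 0
stars (star ∷ w)  = suc (stars w)
stars (_ ∷ w)     = stars w

θ : ∀ {n} → Diagram n → Subset n → ℕ
θ {n} D S = Vec.foldr _ ℕ._+_ 0
  (tabulate (λ j → matched (word D j S) ℕ.+ stars (word D j S)))

-- rational points of ℝⁿ
Point : ℕ → Set
Point n = Fin n → ℚ

ℕ→ℚ : ℕ → ℚ
ℕ→ℚ m = + m / 1

sumOver : ∀ {n} → Subset n → Point n → ℚ
sumOver {n} S x =
  Vec.foldr _ ℚ._+_ ℚ.0ℚ (tabulate (λ i → if lookup S i then x i else ℚ.0ℚ))

InSchubitope : ∀ {n} → Diagram n → Point n → Set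
InSchubitope {n} D x =
  sumOver ⊤ x ≡ ℕ→ℚ (size D) ×
  (∀ (S : Subset n) → S ≢ ⊤ → sumOver S x ℚ.≤ ℕ→ℚ (θ D S))

IsVertex : ∀ {n} → Diagram n → Point n → Set
IsVertex {n} D x =
  InSchubitope D x ×
  (∀ (y z : Point n) (t : ℚ) → InSchubitope D y → InSchubitope D z →
     ℚ.0ℚ ℚ.< t → t ℚ.< ℚ.1ℚ →
     (∀ i → x i ≡ t ℚ.* y i ℚ.+ (ℚ.1ℚ ℚ.- t) ℚ.* z i) →
     ∀ i → y i ≡ z i)

-- x(w):  w_k = w ⟨$⟩ʳ k ;  x_{w_k} = r_D({w_1..w_k}) - r_D({w_1..w_{k-1}})

-- {w_1, …, w_m}  =  { i : position of i in w is < m }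
prefixSet : ∀ {n} → Permutation′ n → ℕ → Subset n
prefixSet w m = tabulate (λ i → toℕ (w ⟨$⟩ˡ i) <ᵇ m)

xOf : ∀ {n} → Diagram n → Permutation′ n → Point n
xOf D w i =
  let k = toℕ (w ⟨$⟩ˡ i) in
  ℕ→ℚ (rankD D (prefixSet w (suc k))) ℚ.- ℕ→ℚ (rankD D (prefixSet w k))

-- Each r_j is a matroid rank function, so r_D is submodular with r_D(∅) = 0.  Reading the
-- word of column j from the top while keeping count of the unmatched "(" computes
-- min_k (#(S ∩ [1,k]) + #(D_j ∩ (k,n])), which is also the rank of S in SM_n(D_j); hence
-- θ_D = r_D and 𝒮_D is the base polytope of r_D.  The vertices of the base polytope of a
-- submodular function are its greedy points (Edmonds).  The point x(w) makes every prefix set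
-- {w_1, …, w_k} tight and satisfies the other inequalities by submodularity; a point of the
-- polytope on which a maximal chain of sets is tight is determined by the chain, so x(w) is a
-- vertex.  Conversely, at a vertex x the tight sets are closed under ∪ and ∩, and they separate
-- any two coordinates i ≠ j: otherwise moving a small ε from x_j to x_i, or back, stays in the
-- polytope and exhibits x as a midpoint.  So every tight set C ≠ [n] can be enlarged by one
-- element to a tight set, the resulting maximal chain of tight sets is the prefix chain of some
-- w, and x = x(w).

module Submission where

open import Defs
open import Data.Fin.Permutation using (Permutation′)
open import Data.Fin.Subset using (Subset; _∪_; _∩_)
open import Data.Nat using (ℕ)
open import Data.Product using (_×_; ∃-syntax; _,_)
open import Data.Rational as ℚ using (ℚ)
open import Function using (_∘_; _⇔_; mk⇔)
import Function.Properties.Equivalence as ⇔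
open import Relation.Binary.PropositionalEquality using (_≡_; sym; trans; cong; subst; subst₂)

module Subsets where

  open import Data.Bool using (Bool; true)
  open import Data.Bool.Properties using (T-≡)
  open import Data.Empty using (⊥-elim)
  open import Data.Fin using (Fin; zero; suc; toℕ; fromℕ<)
  open import Data.Fin.Properties using (toℕ<n; toℕ-fromℕ<; toℕ-injective)
  open import Data.Fin.Permutation using (_⟨$⟩ʳ_; _⟨$⟩ˡ_; inverseˡ; inverseʳ; permutation)
  open import Data.Fin.Subset using (inside; outside; ∣_∣; ⊤; ⊥; ⁅_⁆; _∈_; _∉_; _⊆_)
  open import Data.Fin.Subset.Properties
  open import Data.List as List using ()
  open import Data.List.Membership.Propositional using () renaming (_∈_ to _∈ₗ_)
  open import Data.List.Membership.Propositional.Properties using (∈-++⁺ˡ; ∈-++⁺ʳ; ∈-map⁺)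
  open import Data.List.Relation.Unary.Any using (here)
  open import Data.Nat using (zero; suc; _<_; _≤_; z≤n; s≤s)
  open import Data.Nat.Properties
  open import Data.Product using (Σ-syntax; proj₁; proj₂)
  open import Data.Sum using (inj₁; inj₂; [_,_]′)
  open import Data.Vec using ([]; _∷_; here; there; tabulate)
  open import Data.Vec.Properties using (lookup∘tabulate; []=⇒lookup; lookup⇒[]=)
  open import Function using (Equivalence)
  open import Relation.Binary.Definitions using (tri<; tri≈; tri>)
  open import Relation.Binary.PropositionalEquality using (refl)
  open import Relation.Nullary using (contradiction)

  ∈-allSubsets : ∀ {n} (S : Subset n) → S ∈ₗ allSubsets n
  ∈-allSubsets []                    = here refl
  ∈-allSubsets (inside ∷ S)          = ∈-++⁺ˡ (∈-map⁺ (inside ∷_) (∈-allSubsets S))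
  ∈-allSubsets {suc n} (outside ∷ S) =
    ∈-++⁺ʳ (List.map (inside ∷_) (allSubsets n)) (∈-map⁺ (outside ∷_) (∈-allSubsets S))

  ∈-tabulate⁺ : ∀ {n} {g : Fin n → Bool} {i} → g i ≡ true → i ∈ tabulate g
  ∈-tabulate⁺ {g = g} {i} gi = lookup⇒[]= i (tabulate g) (trans (lookup∘tabulate g i) gi)

  ∈-tabulate⁻ : ∀ {n} {g : Fin n → Bool} {i} → i ∈ tabulate g → g i ≡ true
  ∈-tabulate⁻ {g = g} {i} i∈ = trans (sym (lookup∘tabulate g i)) ([]=⇒lookup i∈)

  ∣∪⁅⁆∣ : ∀ {n} {C : Subset n} {a} → a ∉ C → ∣ C ∪ ⁅ a ⁆ ∣ ≡ suc ∣ C ∣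
  ∣∪⁅⁆∣ {C = inside  ∷ C} {zero}  a∉C = ⊥-elim (a∉C here)
  ∣∪⁅⁆∣ {C = outside ∷ C} {zero}  a∉C = cong (suc ∘ ∣_∣) (∪-identityʳ C)
  ∣∪⁅⁆∣ {C = inside  ∷ C} {suc a} a∉C = cong suc (∣∪⁅⁆∣ (a∉C ∘ there))
  ∣∪⁅⁆∣ {C = outside ∷ C} {suc a} a∉C = ∣∪⁅⁆∣ (a∉C ∘ there)

  ∩⁅⁆-∈ : ∀ {n} {S : Subset n} {a} → a ∈ S → S ∩ ⁅ a ⁆ ≡ ⁅ a ⁆
  ∩⁅⁆-∈ {S = S} a∈S = ⊆-antisym (p∩q⊆q S _)
    (λ b∈⁅a⁆ → x∈p∩q⁺ (subst (_∈ S) (sym (x∈⁅y⁆⇒x≡y _ b∈⁅a⁆)) a∈S , b∈⁅a⁆))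

  ∩⁅⁆-∉ : ∀ {n} {S : Subset n} {a} → a ∉ S → S ∩ ⁅ a ⁆ ≡ ⊥
  ∩⁅⁆-∉ {S = S} a∉S = ⊆-antisym
    (λ b∈ → let (b∈S , b∈⁅a⁆) = x∈p∩q⁻ S _ b∈ in
            ⊥-elim (a∉S (subst (_∈ S) (x∈⁅y⁆⇒x≡y _ b∈⁅a⁆) b∈S)))
    (⊆-min _)

  ∩-∪⁅⁆-∈ : ∀ {n} {S C : Subset n} {a} → a ∈ S → S ∩ (C ∪ ⁅ a ⁆) ≡ (S ∩ C) ∪ ⁅ a ⁆
  ∩-∪⁅⁆-∈ {S = S} {C} a∈S = trans (∩-distribˡ-∪ S C _) (cong ((S ∩ C) ∪_) (∩⁅⁆-∈ a∈S))

  ∩-∪⁅⁆-∉ : ∀ {n} {S C : Subset n} {a} → a ∉ S → S ∩ (C ∪ ⁅ a ⁆) ≡ S ∩ C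
  ∩-∪⁅⁆-∉ {S = S} {C} a∉S =
    trans (∩-distribˡ-∪ S C _) (trans (cong ((S ∩ C) ∪_) (∩⁅⁆-∉ a∉S)) (∪-identityʳ _))

  ∪⁅⁆-∪ : ∀ {n} {B C : Subset n} {a} → B ⊆ C → (B ∪ ⁅ a ⁆) ∪ C ≡ C ∪ ⁅ a ⁆
  ∪⁅⁆-∪ {B = B} {C} B⊆C = ⊆-antisym
    (λ x∈ → [ (λ x∈B∪a → [ x∈p∪q⁺ ∘ inj₁ ∘ B⊆C , x∈p∪q⁺ ∘ inj₂ ]′ (x∈p∪q⁻ B _ x∈B∪a)) ,
              x∈p∪q⁺ ∘ inj₁ ]′ (x∈p∪q⁻ (B ∪ _) C x∈))
    (λ x∈ → [ x∈p∪q⁺ ∘ inj₂ , x∈p∪q⁺ ∘ inj₁ ∘ x∈p∪q⁺ ∘ inj₂ ]′ (x∈p∪q⁻ C _ x∈))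

  ∪⁅⁆-∩ : ∀ {n} {B C : Subset n} {a} → B ⊆ C → a ∉ C → (B ∪ ⁅ a ⁆) ∩ C ≡ B
  ∪⁅⁆-∩ {B = B} {C} B⊆C a∉C = ⊆-antisym
    (λ x∈ → let (x∈B∪a , x∈C) = x∈p∩q⁻ (B ∪ _) C x∈ in
            [ (λ x∈B → x∈B) , (λ x∈a → ⊥-elim (a∉C (subst (_∈ C) (x∈⁅y⁆⇒x≡y _ x∈a) x∈C))) ]′
              (x∈p∪q⁻ B _ x∈B∪a))
    (λ x∈B → x∈p∩q⁺ (x∈p∪q⁺ (inj₁ x∈B) , B⊆C x∈B))

  induction-≤ : ∀ {n} (Q : ℕ → Set) → Q 0 → (∀ (k : Fin n) → Q (toℕ k) → Q (suc (toℕ k))) →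
                ∀ m → m ≤ n → Q m
  induction-≤ Q Q-0 Q-suc zero    _   = Q-0
  induction-≤ Q Q-0 Q-suc (suc m) m<n =
    subst (Q ∘ suc) (toℕ-fromℕ< m<n)
      (Q-suc (fromℕ< m<n) (subst Q (sym (toℕ-fromℕ< m<n)) (induction-≤ Q Q-0 Q-suc m (<⇒≤ m<n))))

  module _ {n : ℕ} (w : Permutation′ n) where

    ∈-prefixSet⁺ : ∀ {m i} → toℕ (w ⟨$⟩ˡ i) < m → i ∈ prefixSet w m
    ∈-prefixSet⁺ lt = ∈-tabulate⁺ (Equivalence.to T-≡ (<⇒<ᵇ lt))

    ∈-prefixSet⁻ : ∀ {m i} → i ∈ prefixSet w m → toℕ (w ⟨$⟩ˡ i) < m
    ∈-prefixSet⁻ {m} i∈ = <ᵇ⇒< _ m (Equivalence.from T-≡ (∈-tabulate⁻ i∈))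

    prefixSet-0 : prefixSet w 0 ≡ ⊥
    prefixSet-0 = ⊆-antisym (λ i∈ → contradiction (∈-prefixSet⁻ {0} i∈) λ ()) (⊆-min _)

    prefixSet-n : prefixSet w n ≡ ⊤
    prefixSet-n = ⊆-antisym ⊆⊤ (λ {i} _ → ∈-prefixSet⁺ (toℕ<n (w ⟨$⟩ˡ i)))

    prefixSet-suc : ∀ k → prefixSet w (suc (toℕ k)) ≡ prefixSet w (toℕ k) ∪ ⁅ w ⟨$⟩ʳ k ⁆
    prefixSet-suc k = ⊆-antisym ⊆∪ ∪⊆
      where
      ⊆∪ : prefixSet w (suc (toℕ k)) ⊆ prefixSet w (toℕ k) ∪ ⁅ w ⟨$⟩ʳ k ⁆
      ⊆∪ i∈ with m<1+n⇒m<n∨m≡n (∈-prefixSet⁻ i∈)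
      ... | inj₁ lt = x∈p∪q⁺ (inj₁ (∈-prefixSet⁺ lt))
      ... | inj₂ eq = x∈p∪q⁺ (inj₂ (subst (_∈ ⁅ w ⟨$⟩ʳ k ⁆)
                        (trans (cong (w ⟨$⟩ʳ_) (sym (toℕ-injective eq))) (inverseʳ w)) (x∈⁅x⁆ _)))
      ∪⊆ : prefixSet w (toℕ k) ∪ ⁅ w ⟨$⟩ʳ k ⁆ ⊆ prefixSet w (suc (toℕ k))
      ∪⊆ i∈ with x∈p∪q⁻ _ _ i∈
      ... | inj₁ i∈C    = ∈-prefixSet⁺ (m<n⇒m<1+n (∈-prefixSet⁻ i∈C))
      ... | inj₂ i∈⁅wk⁆ = subst (_∈ prefixSet w (suc (toℕ k))) (sym (x∈⁅y⁆⇒x≡y _ i∈⁅wk⁆))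
                            (∈-prefixSet⁺ (subst (λ j → toℕ j < suc (toℕ k)) (sym (inverseˡ w)) (n<1+n _)))

    ∉-prefixSet : ∀ k → w ⟨$⟩ʳ k ∉ prefixSet w (toℕ k)
    ∉-prefixSet k i∈ = <-irrefl refl (subst (λ j → toℕ j < toℕ k) (inverseˡ w) (∈-prefixSet⁻ i∈))

  module _ {n : ℕ} (P : Subset n → Set) (P-⊥ : P ⊥)
           (extend : ∀ {C} → P C → ∣ C ∣ < n → ∃[ a ] (a ∉ C × P (C ∪ ⁅ a ⁆))) where

    private
      Stage : ℕ → Set
      Stage m = Σ[ C ∈ Subset n ] (P C × ∣ C ∣ ≡ m)

      extendStage : ∀ {m} → m < n → (c : Stage m) → ∃[ a ] (a ∉ proj₁ c × P (proj₁ c ∪ ⁅ a ⁆))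
      extendStage m<n (C , P-C , refl) = extend P-C m<n

      stage : ∀ m → m ≤ n → Stage m
      stage zero    _   = ⊥ , P-⊥ , ∣⊥∣≡0 n
      stage (suc m) m<n =
        let (C , _ , ∣C∣≡m) = stage m (<⇒≤ m<n)
            (a , a∉C , P-C∪a) = extendStage m<n (stage m (<⇒≤ m<n))
        in C ∪ ⁅ a ⁆ , P-C∪a , trans (∣∪⁅⁆∣ a∉C) (cong suc ∣C∣≡m)

      chain : ∀ m → m ≤ n → Subset n
      chain m m≤n = proj₁ (stage m m≤n)

      next : ∀ m → m < n → Fin n
      next m m<n = proj₁ (extendStage m<n (stage m (<⇒≤ m<n)))

      chain-irrelevant : ∀ m (p q : m ≤ n) → chain m p ≡ chain m q
      chain-irrelevant m p q = cong (chain m) (≤-irrelevant p q)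

      next-irrelevant : ∀ {m m′} → m ≡ m′ → (p : m < n) (q : m′ < n) → next m p ≡ next m′ q
      next-irrelevant {m} refl p q = cong (next m) (<-irrelevant p q)

      next-∉ : ∀ m (m<n : m < n) → next m m<n ∉ chain m (<⇒≤ m<n)
      next-∉ m m<n = proj₁ (proj₂ (extendStage m<n (stage m (<⇒≤ m<n))))

      next-∈ : ∀ m (m<n : m < n) → next m m<n ∈ chain (suc m) m<n
      next-∈ m m<n = x∈p∪q⁺ (inj₂ (x∈⁅x⁆ _))

      chain-mono : ∀ {m m′} (p : m ≤ n) (q : m′ ≤ n) → m ≤ m′ → chain m p ⊆ chain m′ q
      chain-mono {m′ = zero}  p q z≤n = ⊆-reflexive (chain-irrelevant 0 p q)
      chain-mono {m} {suc m′} p q m≤1+m′ with m≤n⇒m<n∨m≡n m≤1+m′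
      ... | inj₂ refl   = ⊆-reflexive (chain-irrelevant m p q)
      ... | inj₁ m<1+m′ = λ a∈ → p⊆p∪q _ (chain-mono p (<⇒≤ q) (≤-pred m<1+m′) a∈)

      chain-n : chain n ≤-refl ≡ ⊤
      chain-n = ∣p∣≡n⇒p≡⊤ (proj₂ (proj₂ (stage n ≤-refl)))

      added : Fin n → Fin n
      added k = next (toℕ k) (toℕ<n k)

      added-∈ : ∀ {m} (p : m ≤ n) k → toℕ k < m → added k ∈ chain m p
      added-∈ p k k<m = chain-mono (toℕ<n k) p k<m (next-∈ (toℕ k) (toℕ<n k))

      added-cover : ∀ m (p : m ≤ n) {a} → a ∈ chain m p → ∃[ k ] (toℕ k < m × added k ≡ a)
      added-cover zero    p a∈ = ⊥-elim (∉⊥ a∈)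
      added-cover (suc m) p a∈ with x∈p∪q⁻ _ _ a∈
      ... | inj₁ a∈C    = let (k , k<m , k↦a) = added-cover m (<⇒≤ p) a∈C in k , m<n⇒m<1+n k<m , k↦a
      ... | inj₂ a∈⁅⁆ = fromℕ< p , s≤s (≤-reflexive (toℕ-fromℕ< p)) ,
                          trans (next-irrelevant (toℕ-fromℕ< p) _ p) (sym (x∈⁅y⁆⇒x≡y _ a∈⁅⁆))

      added-injective : ∀ {k k′} → added k ≡ added k′ → k ≡ k′
      added-injective {k} {k′} same with <-cmp (toℕ k) (toℕ k′)
      ... | tri≈ _ k≡k′ _ = toℕ-injective k≡k′
      ... | tri< k<k′ _ _ =
        ⊥-elim (next-∉ _ (toℕ<n k′) (subst (_∈ chain (toℕ k′) _) same (added-∈ _ k k<k′)))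
      ... | tri> _ _ k′<k =
        ⊥-elim (next-∉ _ (toℕ<n k) (subst (_∈ chain (toℕ k) _) (sym same) (added-∈ _ k′ k′<k)))

      position : Fin n → Fin n
      position a = proj₁ (added-cover n ≤-refl (subst (a ∈_) (sym chain-n) ∈⊤))

      added∘position : ∀ a → added (position a) ≡ a
      added∘position a = proj₂ (proj₂ (added-cover n ≤-refl (subst (a ∈_) (sym chain-n) ∈⊤)))

      position∘added : ∀ k → position (added k) ≡ k
      position∘added k = added-injective (added∘position (added k))

      w : Permutation′ n
      w = permutation added position added∘position position∘added

      prefixSet≡chain : ∀ m (p : m ≤ n) → prefixSet w m ≡ chain m p
      prefixSet≡chain m p = ⊆-antisym ⊆chain chain⊆
        where
        ⊆chain : prefixSet w m ⊆ chain m p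
        ⊆chain {a} a∈ = subst (_∈ chain m p) (added∘position a) (added-∈ p (position a) (∈-prefixSet⁻ w a∈))
        chain⊆ : chain m p ⊆ prefixSet w m
        chain⊆ a∈ = let (k , k<m , k↦a) = added-cover m p a∈ in
          ∈-prefixSet⁺ w (subst (λ j → toℕ j < m) (trans (sym (position∘added k)) (cong position k↦a)) k<m)

    ∃-permutation-prefixSet : ∃[ w ] (∀ m → m ≤ n → P (prefixSet w m))
    ∃-permutation-prefixSet = w , λ m p → subst P (sym (prefixSet≡chain m p)) (proj₁ (proj₂ (stage m p)))

module Polytopes where

  open Subsets
  open import Algebra.Bundles using (CommutativeMonoid)
  open import Data.Bool as Bool using (Bool; true; false; if_then_else_; _∨_; _∧_)
  open import Data.Empty using (⊥-elim)
  open import Data.Fin as Fin using (Fin; zero; suc; toℕ)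
  open import Data.Fin.Properties using (any?; toℕ<n)
  open import Data.Fin.Permutation using (_⟨$⟩ʳ_; _⟨$⟩ˡ_; inverseˡ; inverseʳ)
  open import Data.Fin.Subset using (inside; outside; ∣_∣; ⊤; ⊥; ⁅_⁆; _∈_; _∉_; _⊆_)
  open import Data.Fin.Subset.Properties
  import Data.Integer as ℤ
  import Data.Integer.Properties as ℤ
  open import Data.List using (List; []; _∷_)
  open import Data.List.Membership.Propositional using () renaming (_∈_ to _∈ₗ_)
  open import Data.List.Relation.Unary.Any using (here; there)
  open import Data.Nat as ℕ using (zero; suc)
  import Data.Nat.Properties as ℕ
  open import Data.Nat.Coprimality using (1-coprimeTo) renaming (sym to coprime-sym)
  open import Data.Product using (proj₁; proj₂)
  open import Data.Rational
    using (ℚ; mkℚ; _+_; _*_; _≤_; _-_; -_; _<_; 0ℚ; 1ℚ; ½; _⊓_; _≟_; _<?_; *≤*; positive; nonNegative)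
  open import Data.Rational.Properties
  open import Data.Rational.Solver using (module +-*-Solver)
  open +-*-Solver using (solve; _:+_; _:*_; _:-_; :-_; con; _:=_)
  open import Algebra.Properties.CommutativeSemigroup
    (CommutativeMonoid.commutativeSemigroup +-0-commutativeMonoid) using (interchange)
  open import Data.Sum using (_⊎_; inj₁; inj₂; [_,_]′)
  open import Data.Vec using ([]; _∷_; here; there)
  open import Data.Vec.Properties using (≡-dec)
  open import Function using (Equivalence)
  open import Relation.Binary.PropositionalEquality using (_≢_; refl; cong₂; module ≡-Reasoning)
  open import Relation.Nullary using (Dec; yes; no; does; ¬_; contradiction)
  open import Relation.Nullary.Decidable using (toWitness; _×-dec_; ¬?; dec-true; dec-false; decidable-stable)

  ℕ→ℚ-mkℚ : ∀ m → ℕ→ℚ m ≡ mkℚ (ℤ.+ m) 0 (coprime-sym (1-coprimeTo m))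
  ℕ→ℚ-mkℚ m = normalize-coprime (coprime-sym (1-coprimeTo m))

  ℕ→ℚ-+ : ∀ a b → ℕ→ℚ (a ℕ.+ b) ≡ ℕ→ℚ a + ℕ→ℚ b
  ℕ→ℚ-+ a b rewrite ℕ→ℚ-mkℚ a | ℕ→ℚ-mkℚ b | ℕ.*-identityʳ a | ℕ.*-identityʳ b
                  | ℤ.+◃n≡+n a | ℤ.+◃n≡+n b = refl

  ℕ→ℚ-mono-≤ : ∀ {a b} → a ℕ.≤ b → ℕ→ℚ a ≤ ℕ→ℚ b
  ℕ→ℚ-mono-≤ {a} {b} a≤b rewrite ℕ→ℚ-mkℚ a | ℕ→ℚ-mkℚ b =
    *≤* (subst₂ ℤ._≤_ (sym (ℤ.*-identityʳ (ℤ.+ a))) (sym (ℤ.*-identityʳ (ℤ.+ b))) (ℤ.+≤+ a≤b))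

  p<q⇒0<q-p : ∀ {p q} → p < q → 0ℚ < q - p
  p<q⇒0<q-p {p} {q} p<q = subst (_< q - p) (+-inverseʳ p) (+-monoˡ-< (- p) p<q)

  ≤∧≢⇒< : ∀ {p q} → p ≤ q → p ≢ q → p < q
  ≤∧≢⇒< {p} {q} p≤q p≢q with p <? q
  ... | yes p<q = p<q
  ... | no  p≮q = contradiction (≤-antisym p≤q (≮⇒≥ p≮q)) p≢q

  a+b≡c⇒b≡c-a : ∀ {a b c} → a + b ≡ c → b ≡ c - a
  a+b≡c⇒b≡c-a {a} {b} refl = solve 2 (λ a b → b := (a :+ b) :- a) refl a b

  +-cancelˡ-≡ : ∀ a {b c} → a + b ≡ a + c → b ≡ c
  +-cancelˡ-≡ a {b} {c} a+b≡a+c =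
    trans (a+b≡c⇒b≡c-a a+b≡a+c) (solve 2 (λ a c → (a :+ c) :- a := c) refl a c)

  +-squeeze : ∀ {a b c d} → a ≤ c → b ≤ d → c + d ≤ a + b → a ≡ c × b ≡ d
  +-squeeze a≤c b≤d c+d≤a+b =
    ≤-antisym a≤c (≮⇒≥ λ a<c → <-irrefl refl (<-≤-trans (+-mono-<-≤ a<c b≤d) c+d≤a+b)) ,
    ≤-antisym b≤d (≮⇒≥ λ b<d → <-irrefl refl (<-≤-trans (+-mono-≤-< a≤c b<d) c+d≤a+b))

  convex-≡-bound : ∀ {t a b c} → 0ℚ < t → t < 1ℚ → a ≤ c → b ≤ c →
                   t * a + (1ℚ - t) * b ≡ c → a ≡ c × b ≡ c
  convex-≡-bound {t} {a} {b} {c} 0<t t<1 a≤c b≤c ta+ub≡c =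
    ≤-antisym a≤c (*-cancelˡ-≤-pos t {{positive 0<t}} (≤-reflexive (sym ta≡tc))) ,
    ≤-antisym b≤c (*-cancelˡ-≤-pos (1ℚ - t) {{positive 0<u}} (≤-reflexive (sym ub≡uc)))
    where
    0<u = p<q⇒0<q-p t<1
    tc+uc≡c : t * c + (1ℚ - t) * c ≡ c
    tc+uc≡c = solve 2 (λ t c → t :* c :+ (con 1ℚ :- t) :* c := c) refl t c
    squeezed = +-squeeze (*-monoˡ-≤-nonNeg t {{nonNegative (<⇒≤ 0<t)}} a≤c)
                         (*-monoˡ-≤-nonNeg (1ℚ - t) {{nonNegative (<⇒≤ 0<u)}} b≤c)
                         (≤-reflexive (trans tc+uc≡c (sym ta+ub≡c)))
    ta≡tc = proj₁ squeezed
    ub≡uc = proj₂ squeezed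

  leastPositive : ∀ {A : Set} → (A → ℚ) → List A → ℚ
  leastPositive g []       = 1ℚ
  leastPositive g (a ∷ as) with 0ℚ <? g a
  ... | yes _ = g a ⊓ leastPositive g as
  ... | no  _ = leastPositive g as

  leastPositive-pos : ∀ {A : Set} (g : A → ℚ) as → 0ℚ < leastPositive g as
  leastPositive-pos g []       = toWitness {a? = 0ℚ <? 1ℚ} _
  leastPositive-pos g (a ∷ as) with 0ℚ <? g a
  ... | no  _   = leastPositive-pos g as
  ... | yes 0<a with ⊓-sel (g a) (leastPositive g as)
  ...   | inj₁ eq = subst (0ℚ <_) (sym eq) 0<a
  ...   | inj₂ eq = subst (0ℚ <_) (sym eq) (leastPositive-pos g as)

  leastPositive-≤ : ∀ {A : Set} (g : A → ℚ) {a as} → a ∈ₗ as → 0ℚ < g a → leastPositive g as ≤ g a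
  leastPositive-≤ g {as = b ∷ as} (here refl) 0<a with 0ℚ <? g b
  ... | yes _   = p⊓q≤p (g b) _
  ... | no  0≮a = contradiction 0<a 0≮a
  leastPositive-≤ g {as = b ∷ as} (there a∈) 0<a with 0ℚ <? g b
  ... | yes _ = ≤-trans (p⊓q≤q (g b) _) (leastPositive-≤ g a∈ 0<a)
  ... | no  _ = leastPositive-≤ g a∈ 0<a

  if-+ : ∀ b (u v : ℚ) → (if b then u + v else 0ℚ) ≡ (if b then u else 0ℚ) + (if b then v else 0ℚ)
  if-+ true  u v = refl
  if-+ false u v = refl

  if-* : ∀ b (c u : ℚ) → (if b then c * u else 0ℚ) ≡ c * (if b then u else 0ℚ)
  if-* true  c u = refl
  if-* false c u = sym (*-zeroʳ c)

  if-∨-∧ : ∀ a b (v : ℚ) → (if a ∨ b then v else 0ℚ) + (if a ∧ b then v else 0ℚ) ≡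
                            (if a then v else 0ℚ) + (if b then v else 0ℚ)
  if-∨-∧ true  true  v = refl
  if-∨-∧ true  false v = refl
  if-∨-∧ false true  v = +-comm v 0ℚ
  if-∨-∧ false false v = refl

  sumOver-cong : ∀ {n} (S : Subset n) {x y : Point n} → (∀ i → x i ≡ y i) → sumOver S x ≡ sumOver S y
  sumOver-cong []      x≗y = refl
  sumOver-cong (s ∷ S) x≗y =
    cong₂ (λ u v → (if s then u else 0ℚ) + v) (x≗y zero) (sumOver-cong S (x≗y ∘ suc))

  sumOver-+ : ∀ {n} (S : Subset n) (x y : Point n) → sumOver S (λ i → x i + y i) ≡ sumOver S x + sumOver S y
  sumOver-+ []      x y = refl
  sumOver-+ (s ∷ S) x y =
    trans (cong₂ _+_ (if-+ s (x zero) (y zero)) (sumOver-+ S (x ∘ suc) (y ∘ suc)))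
          (interchange (if s then x zero else 0ℚ) (if s then y zero else 0ℚ)
                       (sumOver S (x ∘ suc)) (sumOver S (y ∘ suc)))

  sumOver-* : ∀ {n} (S : Subset n) c (x : Point n) → sumOver S (λ i → c * x i) ≡ c * sumOver S x
  sumOver-* []      c x = sym (*-zeroʳ c)
  sumOver-* (s ∷ S) c x =
    trans (cong₂ _+_ (if-* s c (x zero)) (sumOver-* S c (x ∘ suc))) (sym (*-distribˡ-+ c _ _))

  sumOver-∪-∩ : ∀ {n} (A B : Subset n) (x : Point n) →
                sumOver (A ∪ B) x + sumOver (A ∩ B) x ≡ sumOver A x + sumOver B x
  sumOver-∪-∩ []      []      x = refl
  sumOver-∪-∩ (a ∷ A) (b ∷ B) x = begin
    (pick (a ∨ b) + sumOver (A ∪ B) xs) + (pick (a ∧ b) + sumOver (A ∩ B) xs)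
      ≡⟨ interchange (pick (a ∨ b)) _ (pick (a ∧ b)) _ ⟩
    (pick (a ∨ b) + pick (a ∧ b)) + (sumOver (A ∪ B) xs + sumOver (A ∩ B) xs)
      ≡⟨ cong₂ _+_ (if-∨-∧ a b (x zero)) (sumOver-∪-∩ A B xs) ⟩
    (pick a + pick b) + (sumOver A xs + sumOver B xs)
      ≡⟨ interchange (pick a) (pick b) _ _ ⟩
    (pick a + sumOver A xs) + (pick b + sumOver B xs) ∎
    where
    open ≡-Reasoning
    xs = x ∘ suc
    pick : Bool → ℚ
    pick s = if s then x zero else 0ℚ

  sumOver-0 : ∀ {n} (S : Subset n) → sumOver S (λ _ → 0ℚ) ≡ 0ℚ
  sumOver-0 []            = refl
  sumOver-0 (inside  ∷ S) = cong (0ℚ +_) (sumOver-0 S)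
  sumOver-0 (outside ∷ S) = cong (0ℚ +_) (sumOver-0 S)

  sumOver-⊥ : ∀ {n} (x : Point n) → sumOver ⊥ x ≡ 0ℚ
  sumOver-⊥ {zero}  x = refl
  sumOver-⊥ {suc n} x = cong (0ℚ +_) (sumOver-⊥ (x ∘ suc))

  sumOver-∪⁅⁆ : ∀ {n} {S : Subset n} {i} → i ∉ S → ∀ x → sumOver (S ∪ ⁅ i ⁆) x ≡ sumOver S x + x i
  sumOver-∪⁅⁆ {S = inside  ∷ S} {zero}  i∉S x = ⊥-elim (i∉S here)
  sumOver-∪⁅⁆ {S = outside ∷ S} {zero}  i∉S x = begin
    x zero + sumOver (S ∪ ⊥) (x ∘ suc)   ≡⟨ cong (λ T → x zero + sumOver T (x ∘ suc)) (∪-identityʳ S) ⟩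
    x zero + sumOver S (x ∘ suc)         ≡⟨ solve 2 (λ a b → a :+ b := (con 0ℚ :+ b) :+ a) refl (x zero) _ ⟩
    (0ℚ + sumOver S (x ∘ suc)) + x zero  ∎
    where open ≡-Reasoning
  sumOver-∪⁅⁆ {S = inside  ∷ S} {suc i} i∉S x =
    trans (cong (x zero +_) (sumOver-∪⁅⁆ (i∉S ∘ there) (x ∘ suc)))
          (sym (+-assoc (x zero) (sumOver S (x ∘ suc)) (x (suc i))))
  sumOver-∪⁅⁆ {S = outside ∷ S} {suc i} i∉S x =
    trans (cong (0ℚ +_) (sumOver-∪⁅⁆ (i∉S ∘ there) (x ∘ suc)))
          (sym (+-assoc 0ℚ (sumOver S (x ∘ suc)) (x (suc i))))

  spike : ∀ {n} → Fin n → ℚ → Point n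
  spike i c k = if does (k Fin.≟ i) then c else 0ℚ

  spike-self : ∀ {n} (i : Fin n) c → spike i c i ≡ c
  spike-self i c rewrite dec-true (i Fin.≟ i) refl = refl

  spike-≢ : ∀ {n} {i k : Fin n} c → k ≢ i → spike i c k ≡ 0ℚ
  spike-≢ {i = i} {k} c k≢i rewrite dec-false (k Fin.≟ i) k≢i = refl

  spike-neg : ∀ {n} (i : Fin n) c k → spike i (- c) k ≡ - spike i c k
  spike-neg i c k with does (k Fin.≟ i)
  ... | true  = refl
  ... | false = refl

  sumOver-spike-∈ : ∀ {n} {S : Subset n} {i} c → i ∈ S → sumOver S (spike i c) ≡ c
  sumOver-spike-∈ {S = inside  ∷ S} {zero}  c _    = trans (cong (c +_) (sumOver-0 S)) (+-identityʳ c)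
  sumOver-spike-∈ {S = inside  ∷ S} {suc i} c (there i∈S) =
    trans (+-identityˡ _) (sumOver-spike-∈ c i∈S)
  sumOver-spike-∈ {S = outside ∷ S} {suc i} c (there i∈S) =
    trans (+-identityˡ _) (sumOver-spike-∈ c i∈S)

  sumOver-spike-∉ : ∀ {n} {S : Subset n} {i} c → i ∉ S → sumOver S (spike i c) ≡ 0ℚ
  sumOver-spike-∉ {S = inside  ∷ S} {zero}  c i∉S = ⊥-elim (i∉S here)
  sumOver-spike-∉ {S = outside ∷ S} {zero}  c _   = cong (0ℚ +_) (sumOver-0 S)
  sumOver-spike-∉ {S = inside  ∷ S} {suc i} c i∉S = trans (+-identityˡ _) (sumOver-spike-∉ c (i∉S ∘ there))
  sumOver-spike-∉ {S = outside ∷ S} {suc i} c i∉S = trans (+-identityˡ _) (sumOver-spike-∉ c (i∉S ∘ there))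

  sumOver-prefixSet-suc : ∀ {n} (w : Permutation′ n) k (x : Point n) →
    sumOver (prefixSet w (suc (toℕ k))) x ≡ sumOver (prefixSet w (toℕ k)) x + x (w ⟨$⟩ʳ k)
  sumOver-prefixSet-suc w k x =
    trans (cong (λ S → sumOver S x) (prefixSet-suc w k)) (sumOver-∪⁅⁆ (∉-prefixSet w k) x)

  -- `IsVertex D` unfolds to `Extreme (InSchubitope D)`.
  Extreme : ∀ {n} → (Point n → Set) → Point n → Set
  Extreme {n} P x =
    P x × (∀ (y z : Point n) (t : ℚ) → P y → P z → 0ℚ < t → t < 1ℚ →
             (∀ i → x i ≡ t * y i + (1ℚ - t) * z i) → ∀ i → y i ≡ z i)

  Extreme-cong : ∀ {n} {P Q : Point n → Set} → (∀ y → P y ⇔ Q y) → ∀ {x} → Extreme P x → Extreme Q x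
  Extreme-cong P⇔Q (Px , extreme) =
    Equivalence.to (P⇔Q _) Px ,
    λ y z t Qy Qz → extreme y z t (Equivalence.from (P⇔Q y) Qy) (Equivalence.from (P⇔Q z) Qz)

  module BasePolytope {n : ℕ} (f : Subset n → ℚ) (f-⊥ : f ⊥ ≡ 0ℚ)
                      (f-submodular : ∀ A B → f (A ∪ B) + f (A ∩ B) ≤ f A + f B) where

    InBase : Point n → Set
    InBase x = sumOver ⊤ x ≡ f ⊤ × (∀ S → S ≢ ⊤ → sumOver S x ≤ f S)

    Tight : Point n → Subset n → Set
    Tight x S = sumOver S x ≡ f S

    greedy : Permutation′ n → Point n
    greedy w i = let k = toℕ (w ⟨$⟩ˡ i) in f (prefixSet w (suc k)) - f (prefixSet w k)

    InBase⇒≤ : ∀ {x} → InBase x → ∀ S → sumOver S x ≤ f S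
    InBase⇒≤ (x⊤≡ , x≤) S with ≡-dec Bool._≟_ S ⊤
    ... | yes refl = ≤-reflexive x⊤≡
    ... | no  S≢⊤  = x≤ S S≢⊤

    tight-⊥ : ∀ x → Tight x ⊥
    tight-⊥ x = trans (sumOver-⊥ x) (sym f-⊥)

    tight-∪-∩ : ∀ {x A B} → InBase x → Tight x A → Tight x B → Tight x (A ∪ B) × Tight x (A ∩ B)
    tight-∪-∩ {x} {A} {B} x∈ A-tight B-tight =
      +-squeeze (InBase⇒≤ x∈ (A ∪ B)) (InBase⇒≤ x∈ (A ∩ B)) (begin
        f (A ∪ B) + f (A ∩ B)                  ≤⟨ f-submodular A B ⟩
        f A + f B                              ≡⟨ cong₂ _+_ (sym A-tight) (sym B-tight) ⟩
        sumOver A x + sumOver B x              ≡⟨ sumOver-∪-∩ A B x ⟨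
        sumOver (A ∪ B) x + sumOver (A ∩ B) x  ∎)
      where open ≤-Reasoning

    f-diminishing : ∀ {B C a} → B ⊆ C → a ∉ C → f (C ∪ ⁅ a ⁆) + f B ≤ f (B ∪ ⁅ a ⁆) + f C
    f-diminishing {B} {C} {a} B⊆C a∉C =
      subst₂ (λ U I → f U + f I ≤ f (B ∪ ⁅ a ⁆) + f C) (∪⁅⁆-∪ B⊆C) (∪⁅⁆-∩ B⊆C a∉C)
        (f-submodular (B ∪ ⁅ a ⁆) C)

    tight-convex : ∀ {x y z t S} → InBase y → InBase z → 0ℚ < t → t < 1ℚ →
                   (∀ i → x i ≡ t * y i + (1ℚ - t) * z i) → Tight x S → Tight y S × Tight z S
    tight-convex {x} {y} {z} {t} {S} y∈ z∈ 0<t t<1 x≡ty+uz S-tight =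
      convex-≡-bound 0<t t<1 (InBase⇒≤ y∈ S) (InBase⇒≤ z∈ S) (begin
        t * sumOver S y + (1ℚ - t) * sumOver S z
          ≡⟨ cong₂ _+_ (sumOver-* S t y) (sumOver-* S (1ℚ - t) z) ⟨
        sumOver S (λ i → t * y i) + sumOver S (λ i → (1ℚ - t) * z i)
          ≡⟨ sumOver-+ S _ _ ⟨
        sumOver S (λ i → t * y i + (1ℚ - t) * z i)
          ≡⟨ sumOver-cong S x≡ty+uz ⟨
        sumOver S x
          ≡⟨ S-tight ⟩
        f S ∎)
      where open ≡-Reasoning

    greedy-at : ∀ w k → greedy w (w ⟨$⟩ʳ k) ≡ f (prefixSet w (suc (toℕ k))) - f (prefixSet w (toℕ k))
    greedy-at w k rewrite inverseˡ w {k} = refl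

    prefix-tight⇒greedy : ∀ {x} w → (∀ m → m ℕ.≤ n → Tight x (prefixSet w m)) → ∀ i → x i ≡ greedy w i
    prefix-tight⇒greedy {x} w tight i = subst (λ j → x j ≡ greedy w j) (inverseʳ w) (at (w ⟨$⟩ˡ i))
      where
      at : ∀ k → x (w ⟨$⟩ʳ k) ≡ greedy w (w ⟨$⟩ʳ k)
      at k = trans (a+b≡c⇒b≡c-a (begin
        f (prefixSet w (toℕ k)) + x (w ⟨$⟩ʳ k)
          ≡⟨ cong (_+ x (w ⟨$⟩ʳ k)) (tight (toℕ k) (ℕ.<⇒≤ (toℕ<n k))) ⟨
        sumOver (prefixSet w (toℕ k)) x + x (w ⟨$⟩ʳ k)
          ≡⟨ sumOver-prefixSet-suc w k x ⟨
        sumOver (prefixSet w (suc (toℕ k))) x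
          ≡⟨ tight (suc (toℕ k)) (toℕ<n k) ⟩
        f (prefixSet w (suc (toℕ k))) ∎)) (sym (greedy-at w k))
        where open ≡-Reasoning

    greedy-tight : ∀ w m → m ℕ.≤ n → Tight (greedy w) (prefixSet w m)
    greedy-tight w = induction-≤ (Tight (greedy w) ∘ prefixSet w) tight-0 tight-suc
      where
      tight-0 : Tight (greedy w) (prefixSet w 0)
      tight-0 = subst (Tight (greedy w)) (sym (prefixSet-0 w)) (tight-⊥ (greedy w))
      tight-suc : ∀ k → Tight (greedy w) (prefixSet w (toℕ k)) → Tight (greedy w) (prefixSet w (suc (toℕ k)))
      tight-suc k C-tight = begin
        sumOver (prefixSet w (suc (toℕ k))) (greedy w)
          ≡⟨ sumOver-prefixSet-suc w k (greedy w) ⟩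
        sumOver (prefixSet w (toℕ k)) (greedy w) + greedy w (w ⟨$⟩ʳ k)
          ≡⟨ cong₂ _+_ C-tight (greedy-at w k) ⟩
        f (prefixSet w (toℕ k)) + (f (prefixSet w (suc (toℕ k))) - f (prefixSet w (toℕ k)))
          ≡⟨ solve 2 (λ a b → a :+ (b :- a) := b) refl (f (prefixSet w (toℕ k))) _ ⟩
        f (prefixSet w (suc (toℕ k))) ∎
        where open ≡-Reasoning

    greedy-≤ : ∀ w S → sumOver S (greedy w) ≤ f S
    greedy-≤ w S = subst (λ T → sumOver T (greedy w) ≤ f T) S∩⊤≡S
      (induction-≤ (λ m → Below (S ∩ prefixSet w m)) below-0 below-suc n ℕ.≤-refl)
      where
      Below : Subset n → Set
      Below T = sumOver T (greedy w) ≤ f T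
      S∩⊤≡S : S ∩ prefixSet w n ≡ S
      S∩⊤≡S = trans (cong (S ∩_) (prefixSet-n w)) (∩-identityʳ S)
      below-0 : Below (S ∩ prefixSet w 0)
      below-0 = subst Below (sym (trans (cong (S ∩_) (prefixSet-0 w)) (∩-zeroʳ S)))
                  (≤-reflexive (tight-⊥ (greedy w)))
      below-suc : ∀ k → Below (S ∩ prefixSet w (toℕ k)) → Below (S ∩ prefixSet w (suc (toℕ k)))
      below-suc k below rewrite prefixSet-suc w k with w ⟨$⟩ʳ k ∈? S
      ... | no  a∉S = subst Below (sym (∩-∪⁅⁆-∉ a∉S)) below
      ... | yes a∈S = subst Below (sym (∩-∪⁅⁆-∈ a∈S)) (begin
        sumOver (B ∪ ⁅ a ⁆) (greedy w)           ≡⟨ sumOver-∪⁅⁆ a∉B (greedy w) ⟩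
        sumOver B (greedy w) + greedy w a        ≤⟨ +-monoˡ-≤ (greedy w a) below ⟩
        f B + greedy w a                         ≡⟨ cong (f B +_) (trans (greedy-at w k)
                                                      (cong (λ T → f T - f C) (prefixSet-suc w k))) ⟩
        f B + (f (C ∪ ⁅ a ⁆) - f C)
          ≡⟨ solve 3 (λ b c′ c → b :+ (c′ :- c) := (c′ :+ b) :- c) refl (f B) (f (C ∪ ⁅ a ⁆)) (f C) ⟩
        (f (C ∪ ⁅ a ⁆) + f B) - f C
          ≤⟨ +-monoˡ-≤ (- f C) (f-diminishing (p∩q⊆q S C) (∉-prefixSet w k)) ⟩
        (f (B ∪ ⁅ a ⁆) + f C) - f C
          ≡⟨ solve 2 (λ b c → (b :+ c) :- c := b) refl (f (B ∪ ⁅ a ⁆)) (f C) ⟩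
        f (B ∪ ⁅ a ⁆) ∎)
        where
        open ≤-Reasoning
        a = w ⟨$⟩ʳ k
        C = prefixSet w (toℕ k)
        B = S ∩ C
        a∉B : a ∉ B
        a∉B a∈B = ∉-prefixSet w k (proj₂ (x∈p∩q⁻ S C a∈B))

    greedy-∈ : ∀ w → InBase (greedy w)
    greedy-∈ w = subst (Tight (greedy w)) (prefixSet-n w) (greedy-tight w n ℕ.≤-refl) ,
                 λ S _ → greedy-≤ w S

    greedy-extreme : ∀ w → Extreme InBase (greedy w)
    greedy-extreme w = greedy-∈ w , λ y z t y∈ z∈ 0<t t<1 g≡ty+uz i →
      let both-tight m m≤n = tight-convex y∈ z∈ 0<t t<1 g≡ty+uz (greedy-tight w m m≤n) in
      trans (prefix-tight⇒greedy w (λ m m≤n → proj₁ (both-tight m m≤n)) i)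
            (sym (prefix-tight⇒greedy w (λ m m≤n → proj₂ (both-tight m m≤n)) i))

    tight-narrow : ∀ {x S C U a b} → InBase x → Tight x S → Tight x C → Tight x U → C ⊆ U →
                   a ∈ S → a ∈ U → b ∉ S → b ∉ C → b ∈ U →
                   ∃[ U′ ] (Tight x U′ × C ⊆ U′ × a ∈ U′ × ∣ U′ ∣ ℕ.< ∣ U ∣)
    tight-narrow {S = S} {C} {U} {a} {b} x∈ S-tight C-tight U-tight C⊆U a∈S a∈U b∉S b∉C b∈U =
      (S ∪ C) ∩ U ,
      proj₂ (tight-∪-∩ x∈ (proj₁ (tight-∪-∩ x∈ S-tight C-tight)) U-tight) ,
      (λ c∈C → x∈p∩q⁺ (x∈p∪q⁺ (inj₂ c∈C) , C⊆U c∈C)) ,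
      x∈p∩q⁺ (x∈p∪q⁺ (inj₁ a∈S) , a∈U) ,
      p⊂q⇒∣p∣<∣q∣ (p∩q⊆q (S ∪ C) U , b , b∈U , b∉U′)
      where
      b∉U′ : b ∉ (S ∪ C) ∩ U
      b∉U′ b∈ = [ b∉S , b∉C ]′ (x∈p∪q⁻ S C (proj₁ (x∈p∩q⁻ (S ∪ C) U b∈)))

    module _ {x : Point n} (x-extreme : Extreme InBase x) where

      private
        x∈ : InBase x
        x∈ = proj₁ x-extreme

        slack : Subset n → ℚ
        slack S = f S - sumOver S x

        -- Moving ε between two coordinates that no tight set separates violates no inequality.
        ε : ℚ
        ε = leastPositive slack (allSubsets n)

        0<ε : 0ℚ < ε
        0<ε = leastPositive-pos slack (allSubsets n)

        ε≤slack : ∀ S → ¬ Tight x S → ε ≤ slack S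
        ε≤slack S S-loose = leastPositive-≤ slack (∈-allSubsets S)
          (p<q⇒0<q-p (≤∧≢⇒< (InBase⇒≤ x∈ S) S-loose))

        shift : Fin n → Fin n → Point n
        shift i j k = x k + (spike i ε k + spike j (- ε) k)

        moved : Fin n → Fin n → Subset n → ℚ
        moved i j S = sumOver S (spike i ε) + sumOver S (spike j (- ε))

        sumOver-shift : ∀ i j S → sumOver S (shift i j) ≡ sumOver S x + moved i j S
        sumOver-shift i j S =
          trans (sumOver-+ S x _) (cong (sumOver S x +_) (sumOver-+ S (spike i ε) (spike j (- ε))))

        moved-≡0 : ∀ {i j S} → (i ∈ S → j ∈ S) → (j ∈ S → i ∈ S) → moved i j S ≡ 0ℚ
        moved-≡0 {i} {j} {S} i⇒j j⇒i with i ∈? S | j ∈? S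
        ... | yes i∈S | yes j∈S =
          trans (cong₂ _+_ (sumOver-spike-∈ ε i∈S) (sumOver-spike-∈ (- ε) j∈S)) (+-inverseʳ ε)
        ... | no  i∉S | no  j∉S = cong₂ _+_ (sumOver-spike-∉ ε i∉S) (sumOver-spike-∉ (- ε) j∉S)
        ... | yes i∈S | no  j∉S = contradiction (i⇒j i∈S) j∉S
        ... | no  i∉S | yes j∈S = contradiction (j⇒i j∈S) i∉S

        moved-≤ε : ∀ i j S → moved i j S ≤ ε
        moved-≤ε i j S with i ∈? S | j ∈? S
        ... | yes i∈S | yes j∈S = begin
          sumOver S (spike i ε) + sumOver S (spike j (- ε))
            ≡⟨ cong₂ _+_ (sumOver-spike-∈ ε i∈S) (sumOver-spike-∈ (- ε) j∈S) ⟩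
          ε + - ε  ≡⟨ +-inverseʳ ε ⟩
          0ℚ       ≤⟨ <⇒≤ 0<ε ⟩
          ε        ∎
          where open ≤-Reasoning
        ... | yes i∈S | no  j∉S = begin
          sumOver S (spike i ε) + sumOver S (spike j (- ε))
            ≡⟨ cong₂ _+_ (sumOver-spike-∈ ε i∈S) (sumOver-spike-∉ (- ε) j∉S) ⟩
          ε + 0ℚ   ≡⟨ +-identityʳ ε ⟩
          ε        ∎
          where open ≤-Reasoning
        ... | no  i∉S | yes j∈S = begin
          sumOver S (spike i ε) + sumOver S (spike j (- ε))
            ≡⟨ cong₂ _+_ (sumOver-spike-∉ ε i∉S) (sumOver-spike-∈ (- ε) j∈S) ⟩
          0ℚ + - ε ≡⟨ +-identityˡ (- ε) ⟩
          - ε      ≤⟨ neg-antimono-≤ (<⇒≤ 0<ε) ⟩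
          0ℚ       ≤⟨ <⇒≤ 0<ε ⟩
          ε        ∎
          where open ≤-Reasoning
        ... | no  i∉S | no  j∉S = begin
          sumOver S (spike i ε) + sumOver S (spike j (- ε))
            ≡⟨ cong₂ _+_ (sumOver-spike-∉ ε i∉S) (sumOver-spike-∉ (- ε) j∉S) ⟩
          0ℚ       ≤⟨ <⇒≤ 0<ε ⟩
          ε        ∎
          where open ≤-Reasoning

        Unseparated : Fin n → Fin n → Set
        Unseparated i j = ∀ {S} → Tight x S → i ∈ S → j ∈ S

        shift-∈ : ∀ {i j} → Unseparated i j → Unseparated j i → InBase (shift i j)
        shift-∈ {i} {j} i⇒j j⇒i = shift-⊤ , shift-≤
          where
          shift-⊤ : sumOver ⊤ (shift i j) ≡ f ⊤
          shift-⊤ = begin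
            sumOver ⊤ (shift i j)  ≡⟨ sumOver-shift i j ⊤ ⟩
            sumOver ⊤ x + moved i j ⊤  ≡⟨ cong (sumOver ⊤ x +_) (moved-≡0 (λ _ → ∈⊤) (λ _ → ∈⊤)) ⟩
            sumOver ⊤ x + 0ℚ       ≡⟨ +-identityʳ _ ⟩
            sumOver ⊤ x            ≡⟨ proj₁ x∈ ⟩
            f ⊤                    ∎
            where open ≡-Reasoning
          shift-≤ : ∀ S → S ≢ ⊤ → sumOver S (shift i j) ≤ f S
          shift-≤ S _ with sumOver S x ≟ f S
          ... | yes S-tight = begin
            sumOver S (shift i j)      ≡⟨ sumOver-shift i j S ⟩
            sumOver S x + moved i j S  ≡⟨ cong (sumOver S x +_) (moved-≡0 (i⇒j S-tight) (j⇒i S-tight)) ⟩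
            sumOver S x + 0ℚ           ≡⟨ +-identityʳ _ ⟩
            sumOver S x                ≡⟨ S-tight ⟩
            f S                        ∎
            where open ≤-Reasoning
          ... | no S-loose = begin
            sumOver S (shift i j)      ≡⟨ sumOver-shift i j S ⟩
            sumOver S x + moved i j S
              ≤⟨ +-monoʳ-≤ (sumOver S x) (≤-trans (moved-≤ε i j S) (ε≤slack S S-loose)) ⟩
            sumOver S x + slack S      ≡⟨ solve 2 (λ s c → s :+ (c :- s) := c) refl (sumOver S x) (f S) ⟩
            f S                        ∎
            where open ≤-Reasoning

        unseparated-absurd : ∀ {i j} → i ≢ j → ¬ (Unseparated i j × Unseparated j i)
        unseparated-absurd {i} {j} i≢j (i⇒j , j⇒i) =
          <-asym 0<ε (subst (_< 0ℚ) (sym ε≡-ε) (neg-antimono-< 0<ε))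
          where
          midpoint : ∀ k → x k ≡ ½ * shift i j k + (1ℚ - ½) * shift j i k
          midpoint k rewrite spike-neg i ε k | spike-neg j ε k =
            solve 3 (λ x a b → x := con ½ :* (x :+ (a :+ :- b)) :+ (con 1ℚ :- con ½) :* (x :+ (b :+ :- a)))
              refl (x k) (spike i ε k) (spike j ε k)
          shifts-agree : shift i j i ≡ shift j i i
          shifts-agree = proj₂ x-extreme (shift i j) (shift j i) ½ (shift-∈ i⇒j j⇒i) (shift-∈ j⇒i i⇒j)
                           (toWitness {a? = 0ℚ <? ½} _) (toWitness {a? = ½ <? 1ℚ} _) midpoint i
          ε≡-ε : ε ≡ - ε
          ε≡-ε = begin
            ε                                  ≡⟨ +-identityʳ ε ⟨
            ε + 0ℚ                             ≡⟨ cong₂ _+_ (spike-self i ε) (spike-≢ (- ε) i≢j) ⟨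
            spike i ε i + spike j (- ε) i      ≡⟨ +-cancelˡ-≡ (x i) shifts-agree ⟩
            spike j ε i + spike i (- ε) i      ≡⟨ cong₂ _+_ (spike-≢ ε i≢j) (spike-self i (- ε)) ⟩
            0ℚ + - ε                           ≡⟨ +-identityˡ (- ε) ⟩
            - ε                                ∎
            where open ≡-Reasoning

        separator? : ∀ i j → Dec (∃[ S ] (Tight x S × i ∈ S × j ∉ S))
        separator? i j = anySubset? (λ S → (sumOver S x ≟ f S) ×-dec (i ∈? S ×-dec ¬? (j ∈? S)))

        unseparated : ∀ {i j} → ¬ (∃[ S ] (Tight x S × i ∈ S × j ∉ S)) → Unseparated i j
        unseparated {i} {j} ∄S {S} S-tight i∈S =
          decidable-stable (j ∈? S) (λ j∉S → ∄S (S , S-tight , i∈S , j∉S))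

      tight-separates : ∀ {i j} → i ≢ j →
                        ∃[ S ] (Tight x S × i ∈ S × j ∉ S) ⊎ ∃[ S ] (Tight x S × j ∈ S × i ∉ S)
      tight-separates {i} {j} i≢j with separator? i j | separator? j i
      ... | yes S-ij | _        = inj₁ S-ij
      ... | no  _    | yes S-ji = inj₂ S-ji
      ... | no  ∄ij  | no  ∄ji  = ⊥-elim (unseparated-absurd i≢j (unseparated ∄ij , unseparated ∄ji))

      -- U stays tight and above C and loses elements until U ∖ C = {a}; N bounds ∣ U ∣.
      shrink : ∀ N {C U i} → ∣ U ∣ ℕ.≤ N → Tight x C → Tight x U → C ⊆ U → i ∈ U → i ∉ C →
               ∃[ a ] (a ∉ C × Tight x (C ∪ ⁅ a ⁆))
      shrink zero {U = U} {i} ∣U∣≤0 _ _ _ i∈U _ =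
        contradiction (ℕ.<-≤-trans 0<∣U∣ ∣U∣≤0) λ ()
        where
        0<∣U∣ : 0 ℕ.< ∣ U ∣
        0<∣U∣ = subst (ℕ._< ∣ U ∣) (∣⊥∣≡0 n) (p⊂q⇒∣p∣<∣q∣ (⊆-min U , i , i∈U , ∉⊥))
      shrink (suc N) {C} {U} {i} ∣U∣≤ C-tight U-tight C⊆U i∈U i∉C
        with any? (λ j → j ∈? U ×-dec (¬? (j ∈? C) ×-dec ¬? (j Fin.≟ i)))
      ... | no ∄j = i , i∉C , subst (Tight x) U≡C∪⁅i⁆ U-tight
        where
        U⊆ : U ⊆ C ∪ ⁅ i ⁆
        U⊆ {j} j∈U with j ∈? C | j Fin.≟ i
        ... | yes j∈C | _        = x∈p∪q⁺ (inj₁ j∈C)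
        ... | no  _   | yes refl = x∈p∪q⁺ (inj₂ (x∈⁅x⁆ j))
        ... | no  j∉C | no  j≢i  = ⊥-elim (∄j (j , j∈U , j∉C , j≢i))
        U≡C∪⁅i⁆ : U ≡ C ∪ ⁅ i ⁆
        U≡C∪⁅i⁆ = ⊆-antisym U⊆ (λ j∈ → [ C⊆U , (λ j∈⁅i⁆ → subst (_∈ U) (sym (x∈⁅y⁆⇒x≡y i j∈⁅i⁆)) i∈U) ]′
                                          (x∈p∪q⁻ C ⁅ i ⁆ j∈))
      ... | yes (j , j∈U , j∉C , j≢i) with tight-separates j≢i
      ...   | inj₁ (S , S-tight , j∈S , i∉S) =
        let (U′ , U′-tight , C⊆U′ , j∈U′ , ∣U′∣<∣U∣) =
              tight-narrow x∈ S-tight C-tight U-tight C⊆U j∈S j∈U i∉S i∉C i∈U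
        in shrink N (ℕ.≤-pred (ℕ.<-≤-trans ∣U′∣<∣U∣ ∣U∣≤)) C-tight U′-tight C⊆U′ j∈U′ j∉C
      ...   | inj₂ (S , S-tight , i∈S , j∉S) =
        let (U′ , U′-tight , C⊆U′ , i∈U′ , ∣U′∣<∣U∣) =
              tight-narrow x∈ S-tight C-tight U-tight C⊆U i∈S i∈U j∉S j∉C j∈U
        in shrink N (ℕ.≤-pred (ℕ.<-≤-trans ∣U′∣<∣U∣ ∣U∣≤)) C-tight U′-tight C⊆U′ i∈U′ i∉C

      tight-extend : ∀ {C} → Tight x C → ∣ C ∣ ℕ.< n → ∃[ a ] (a ∉ C × Tight x (C ∪ ⁅ a ⁆))
      tight-extend {C} C-tight ∣C∣<n with any? (λ i → ¬? (i ∈? C))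
      ... | yes (i , i∉C) = shrink n (∣p∣≤n ⊤) C-tight (proj₁ x∈) ⊆⊤ ∈⊤ i∉C
      ... | no  ∄i        = contradiction (trans (cong ∣_∣ C≡⊤) (∣⊤∣≡n n)) (ℕ.<⇒≢ ∣C∣<n)
        where
        C≡⊤ : C ≡ ⊤
        C≡⊤ = ⊆-antisym ⊆⊤ (λ {i} _ → decidable-stable (i ∈? C) (λ i∉C → ∄i (i , i∉C)))

    extreme⇒greedy : ∀ {x} → Extreme InBase x → ∃[ w ] (∀ i → x i ≡ greedy w i)
    extreme⇒greedy {x} x-extreme =
      let (w , prefixes-tight) = ∃-permutation-prefixSet (Tight x) (tight-⊥ x) (tight-extend x-extreme)
      in w , prefix-tight⇒greedy w prefixes-tight

module SchubertMatroid where

  open Subsets using (∈-allSubsets)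
  open import Data.Bool using (Bool; true; false; _∧_; _∨_; T?)
  open import Data.Bool.Properties using (T-≡; ∧-conicalʳ; ∧-comm)
  open import Data.Fin using (Fin; zero; suc; toℕ)
  open import Data.Fin.Subset using (inside; outside; ∣_∣; ⊤; ⊥)
  open import Data.Fin.Subset.Properties using (∣p∩q∣≤∣q∣; ∩-comm)
  open import Data.List as List using (List; []; _∷_; _++_; length)
  import Data.List.Properties as List
  open import Data.List.Membership.Propositional using () renaming (_∈_ to _∈ₗ_)
  open import Data.List.Membership.Propositional.Properties using (∈-filter⁺; ∈-filter⁻)
  open import Data.List.Relation.Unary.All as All using (All; []; _∷_)
  open import Data.List.Relation.Unary.All.Properties using (∷ʳ⁺)
  open import Data.List.Relation.Unary.Any using (here; there)
  open import Data.Nat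
  open import Data.Nat.Properties
  open import Algebra.Properties.CommutativeSemigroup +-commutativeSemigroup using (interchange)
  open import Data.Vec as Vec using ([]; _∷_; tabulate; lookup)
  import Data.Vec.Properties as Vec
  open import Data.Sum using (inj₁; inj₂)
  open import Data.Product using (proj₁; proj₂)
  open import Function using (id; Equivalence)
  open import Relation.Binary.PropositionalEquality
  open import Relation.Nullary using (does; contradiction)
  open import Relation.Nullary.Decidable using (dec-true)

  Bool→ℕ : Bool → ℕ
  Bool→ℕ true  = 1
  Bool→ℕ false = 0

  ∣∷∣ : ∀ {n} b (S : Subset n) → ∣ b ∷ S ∣ ≡ Bool→ℕ b + ∣ S ∣
  ∣∷∣ true  S = refl
  ∣∷∣ false S = refl

  Bool→ℕ-∧ˡ : ∀ a b → Bool→ℕ (a ∧ b) ≤ Bool→ℕ a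
  Bool→ℕ-∧ˡ true  true  = ≤-refl
  Bool→ℕ-∧ˡ true  false = z≤n
  Bool→ℕ-∧ˡ false b     = z≤n

  Bool→ℕ-∨-∧ : ∀ a b → Bool→ℕ (a ∨ b) + Bool→ℕ (a ∧ b) ≡ Bool→ℕ a + Bool→ℕ b
  Bool→ℕ-∨-∧ true  true  = refl
  Bool→ℕ-∨-∧ true  false = refl
  Bool→ℕ-∨-∧ false true  = refl
  Bool→ℕ-∨-∧ false false = refl

  -- min_k (#(A ∩ [1,k]) + #(S ∩ (k,n])), unfolded from the first row
  rankFormula : ∀ {n} → Subset n → Subset n → ℕ
  rankFormula []      []      = 0
  rankFormula (s ∷ S) (a ∷ A) = ∣ s ∷ S ∣ ⊓ (Bool→ℕ a + rankFormula S A)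

  rankFormula≤∣S∣ : ∀ {n} (S A : Subset n) → rankFormula S A ≤ ∣ S ∣
  rankFormula≤∣S∣ []      []      = z≤n
  rankFormula≤∣S∣ (s ∷ S) (a ∷ A) = m⊓n≤m _ _

  -- `gale k B S`: granting B a head start of k elements, every prefix of B has at least as many
  -- elements as the same prefix of S, and the totals agree.
  gale : ∀ {n} → ℕ → Subset n → Subset n → Bool
  gale k       []            []            = k ≡ᵇ 0
  gale k       (inside  ∷ B) (inside  ∷ S) = gale k B S
  gale k       (inside  ∷ B) (outside ∷ S) = gale (suc k) B S
  gale k       (outside ∷ B) (outside ∷ S) = gale k B S
  gale zero    (outside ∷ B) (inside  ∷ S) = false
  gale (suc k) (outside ∷ B) (inside  ∷ S) = gale k B S

  pointwise≤ᵇ : List ℕ → List ℕ → Bool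
  pointwise≤ᵇ []       []       = true
  pointwise≤ᵇ []       (_ ∷ _)  = false
  pointwise≤ᵇ (_ ∷ _)  []       = false
  pointwise≤ᵇ (a ∷ as) (b ∷ bs) = (a ≤ᵇ b) ∧ pointwise≤ᵇ as bs

  pointwiseLeq≡pointwise≤ᵇ : ∀ {n} (as bs : List (Fin n)) →
                             pointwiseLeq as bs ≡ pointwise≤ᵇ (List.map toℕ as) (List.map toℕ bs)
  pointwiseLeq≡pointwise≤ᵇ []       []       = refl
  pointwiseLeq≡pointwise≤ᵇ []       (_ ∷ _)  = refl
  pointwiseLeq≡pointwise≤ᵇ (_ ∷ _)  []       = refl
  pointwiseLeq≡pointwise≤ᵇ (a ∷ as) (b ∷ bs) =
    cong ((toℕ a ≤ᵇ toℕ b) ∧_) (pointwiseLeq≡pointwise≤ᵇ as bs)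

  elementsFrom : ∀ {n} → ℕ → Subset n → List ℕ
  elementsFrom o []            = []
  elementsFrom o (inside  ∷ B) = o ∷ elementsFrom (suc o) B
  elementsFrom o (outside ∷ B) = elementsFrom (suc o) B

  map-shift : ∀ {n} o (is : List (Fin n)) →
              List.map (λ i → o + toℕ i) (List.map suc is) ≡ List.map (λ i → suc o + toℕ i) is
  map-shift o is = trans (sym (List.map-∘ is)) (List.map-cong (λ i → +-suc o (toℕ i)) is)

  map-elements : ∀ {n} o (B : Subset n) → List.map (λ i → o + toℕ i) (elements B) ≡ elementsFrom o B
  map-elements o []            = refl
  map-elements o (inside  ∷ B) =
    cong₂ _∷_ (+-identityʳ o) (trans (map-shift o (elements B)) (map-elements (suc o) B))
  map-elements o (outside ∷ B) = trans (map-shift o (elements B)) (map-elements (suc o) B)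

  ≤ᵇ-true : ∀ {m n} → m ≤ n → (m ≤ᵇ n) ≡ true
  ≤ᵇ-true = Equivalence.to T-≡ ∘ ≤⇒≤ᵇ

  ≤ᵇ-false : ∀ {m n} → n < m → (m ≤ᵇ n) ≡ false
  ≤ᵇ-false {m} {n} n<m with m ≤ᵇ n in m≤ᵇn
  ... | false = refl
  ... | true  = contradiction (≤ᵇ⇒≤ m n (Equivalence.from T-≡ m≤ᵇn)) (<⇒≱ n<m)

  pointwise≤ᵇ-elementsFrom-< : ∀ {n e o} (B : Subset n) bs → o < e →
                               pointwise≤ᵇ (elementsFrom e B) (o ∷ bs) ≡ false
  pointwise≤ᵇ-elementsFrom-< []            bs o<e = refl
  pointwise≤ᵇ-elementsFrom-< (inside  ∷ B) bs o<e rewrite ≤ᵇ-false o<e = refl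
  pointwise≤ᵇ-elementsFrom-< (outside ∷ B) bs o<e = pointwise≤ᵇ-elementsFrom-< B bs (m<n⇒m<1+n o<e)

  -- `ps` are the elements of B already read that still wait for their partner in S.
  mutual
    pointwise≤ᵇ-gale : ∀ {n o} (B S : Subset n) ps → All (_≤ o) ps →
                       pointwise≤ᵇ (ps ++ elementsFrom o B) (elementsFrom o S) ≡ gale (length ps) B S
    pointwise≤ᵇ-gale []            []            []       _ = refl
    pointwise≤ᵇ-gale []            []            (_ ∷ _)  _ = refl
    pointwise≤ᵇ-gale {o = o} (inside ∷ B) (inside ∷ S) [] _ rewrite ≤ᵇ-true (≤-refl {o}) =
      pointwise≤ᵇ-gale B S [] []
    pointwise≤ᵇ-gale (inside  ∷ B) (inside  ∷ S) (p ∷ ps) (p≤o ∷ ps≤o) rewrite ≤ᵇ-true p≤o =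
      pointwise≤ᵇ-gale-pending B S ps ps≤o
    pointwise≤ᵇ-gale (inside  ∷ B) (outside ∷ S) ps       ps≤o = pointwise≤ᵇ-gale-pending B S ps ps≤o
    pointwise≤ᵇ-gale {o = o} (outside ∷ B) (inside ∷ S) [] _ =
      pointwise≤ᵇ-elementsFrom-< B _ (n<1+n o)
    pointwise≤ᵇ-gale (outside ∷ B) (inside  ∷ S) (p ∷ ps) (p≤o ∷ ps≤o) rewrite ≤ᵇ-true p≤o =
      pointwise≤ᵇ-gale B S ps (All.map m≤n⇒m≤1+n ps≤o)
    pointwise≤ᵇ-gale (outside ∷ B) (outside ∷ S) ps       ps≤o =
      pointwise≤ᵇ-gale B S ps (All.map m≤n⇒m≤1+n ps≤o)

    pointwise≤ᵇ-gale-pending : ∀ {n o} (B S : Subset n) ps → All (_≤ o) ps →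
                               pointwise≤ᵇ (ps ++ o ∷ elementsFrom (suc o) B) (elementsFrom (suc o) S) ≡
                               gale (suc (length ps)) B S
    pointwise≤ᵇ-gale-pending {o = o} B S ps ps≤o = begin
      pointwise≤ᵇ (ps ++ o ∷ elementsFrom (suc o) B) (elementsFrom (suc o) S)
        ≡⟨ cong (λ bs → pointwise≤ᵇ bs (elementsFrom (suc o) S)) (List.++-assoc ps (o ∷ []) _) ⟨
      pointwise≤ᵇ ((ps ++ o ∷ []) ++ elementsFrom (suc o) B) (elementsFrom (suc o) S)
        ≡⟨ pointwise≤ᵇ-gale B S (ps ++ o ∷ []) (∷ʳ⁺ (All.map m≤n⇒m≤1+n ps≤o) (n≤1+n o)) ⟩
      gale (length (ps ++ o ∷ [])) B S
        ≡⟨ cong (λ k → gale k B S) (trans (List.length-++ ps) (+-comm (length ps) 1)) ⟩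
      gale (suc (length ps)) B S ∎
      where open ≡-Reasoning

  pointwiseLeq-elements≡gale : ∀ {n} (B S : Subset n) →
                               pointwiseLeq (elements B) (elements S) ≡ gale 0 B S
  pointwiseLeq-elements≡gale B S =
    trans (pointwiseLeq≡pointwise≤ᵇ (elements B) (elements S))
          (trans (cong₂ pointwise≤ᵇ (map-elements 0 B) (map-elements 0 S)) (pointwise≤ᵇ-gale B S [] []))

  gale-∣∣ : ∀ {n} k (B S : Subset n) → gale k B S ≡ true → ∣ B ∣ + k ≡ ∣ S ∣
  gale-∣∣ zero    []            []            _  = refl
  gale-∣∣ (suc k) []            []            ()
  gale-∣∣ k       (inside  ∷ B) (inside  ∷ S) g = cong suc (gale-∣∣ k B S g)
  gale-∣∣ k       (inside  ∷ B) (outside ∷ S) g = trans (sym (+-suc ∣ B ∣ k)) (gale-∣∣ (suc k) B S g)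
  gale-∣∣ k       (outside ∷ B) (outside ∷ S) g = gale-∣∣ k B S g
  gale-∣∣ (suc k) (outside ∷ B) (inside  ∷ S) g = trans (+-suc ∣ B ∣ k) (cong suc (gale-∣∣ k B S g))
  gale-∣∣ zero    (outside ∷ B) (inside  ∷ S) ()

  gale-tail : ∀ {n} k b s (B S : Subset n) → gale k (b ∷ B) (s ∷ S) ≡ true →
              ∃[ k′ ] (gale k′ B S ≡ true)
  gale-tail k       inside  inside  B S g = k , g
  gale-tail k       inside  outside B S g = suc k , g
  gale-tail k       outside outside B S g = k , g
  gale-tail (suc k) outside inside  B S g = k , g
  gale-tail zero    outside inside  B S ()

  gale⇒∣A∩B∣≤rankFormula : ∀ {n} k (B S A : Subset n) → gale k B S ≡ true →
                           ∣ A ∩ B ∣ ≤ rankFormula S A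
  gale⇒∣A∩B∣≤rankFormula k []      []      []      _ = z≤n
  gale⇒∣A∩B∣≤rankFormula k (b ∷ B) (s ∷ S) (a ∷ A) g = ⊓-glb
    (≤-trans (∣p∩q∣≤∣q∣ (a ∷ A) (b ∷ B))
             (≤-trans (m≤m+n _ k) (≤-reflexive (gale-∣∣ k (b ∷ B) (s ∷ S) g))))
    (≤-trans (≤-reflexive (∣∷∣ (a ∧ b) (A ∩ B)))
             (+-mono-≤ (Bool→ℕ-∧ˡ a b) (gale⇒∣A∩B∣≤rankFormula k′ B S A g′)))
    where
    k′ = proj₁ (gale-tail k b s B S g)
    g′ = proj₂ (gale-tail k b s B S g)

  -- B takes the elements of A whenever the Gale condition leaves room, other elements only when forced.
  ∃-gale-rankFormula : ∀ {n} k (S A : Subset n) → k ≤ ∣ S ∣ →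
                       ∃[ B ] (gale k B S ≡ true × (∣ S ∣ ∸ k) ⊓ rankFormula S A ≤ ∣ A ∩ B ∣)
  ∃-gale-rankFormula zero    []            []            _  = [] , refl , z≤n
  ∃-gale-rankFormula k       (inside  ∷ S) (inside  ∷ A) k≤ with m≤n⇒m<n∨m≡n k≤
  ... | inj₁ k<1+∣S∣ =
    let (B , g , r≤) = ∃-gale-rankFormula k S A (≤-pred k<1+∣S∣) in
    inside ∷ B , g ,
    ≤-trans (≤-reflexive (cong (_⊓ rankFormula (inside ∷ S) (inside ∷ A)) (+-∸-assoc 1 (≤-pred k<1+∣S∣))))
            (s≤s (≤-trans (⊓-monoʳ-≤ (∣ S ∣ ∸ k) (m⊓n≤n ∣ S ∣ (rankFormula S A))) r≤))
  ... | inj₂ refl =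
    let (B , g , _) = ∃-gale-rankFormula ∣ S ∣ S A ≤-refl in
    outside ∷ B , g ,
    ≤-trans (≤-reflexive (cong (_⊓ rankFormula (inside ∷ S) (inside ∷ A)) (n∸n≡0 ∣ S ∣))) z≤n
  ∃-gale-rankFormula k       (outside ∷ S) (inside  ∷ A) k≤ with m≤n⇒m<n∨m≡n k≤
  ... | inj₁ k<∣S∣ =
    let (B , g , r≤) = ∃-gale-rankFormula (suc k) S A k<∣S∣ in
    inside ∷ B , g ,
    ≤-trans (≤-reflexive (cong (_⊓ rankFormula (outside ∷ S) (inside ∷ A)) (+-∸-assoc 1 k<∣S∣)))
            (≤-trans (⊓-monoʳ-≤ (suc (∣ S ∣ ∸ suc k)) (m⊓n≤n ∣ S ∣ (suc (rankFormula S A)))) (s≤s r≤))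
  ... | inj₂ refl =
    let (B , g , _) = ∃-gale-rankFormula k S A k≤ in
    outside ∷ B , g ,
    ≤-trans (≤-reflexive (cong (_⊓ rankFormula (outside ∷ S) (inside ∷ A)) (n∸n≡0 ∣ S ∣))) z≤n
  ∃-gale-rankFormula k       (outside ∷ S) (outside ∷ A) k≤ =
    let (B , g , r≤) = ∃-gale-rankFormula k S A k≤ in
    outside ∷ B , g , ≤-trans (⊓-monoʳ-≤ (∣ S ∣ ∸ k) (m⊓n≤n ∣ S ∣ (rankFormula S A))) r≤
  ∃-gale-rankFormula zero    (inside  ∷ S) (outside ∷ A) _  =
    let (B , g , r≤) = ∃-gale-rankFormula zero S A z≤n in
    inside ∷ B , g ,
    ≤-trans (m⊓n≤n _ _) (≤-trans (m⊓n≤n _ _)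
      (subst (_≤ ∣ A ∩ B ∣) (m≥n⇒m⊓n≡n (rankFormula≤∣S∣ S A)) r≤))
  ∃-gale-rankFormula (suc k) (inside  ∷ S) (outside ∷ A) k≤ =
    let (B , g , r≤) = ∃-gale-rankFormula k S A (≤-pred k≤) in
    outside ∷ B , g , ≤-trans (⊓-monoʳ-≤ (∣ S ∣ ∸ k) (m⊓n≤n (suc ∣ S ∣) (rankFormula S A))) r≤

  foldr-⊔-≤ : ∀ {X : Set} (g : X → ℕ) {c} xs → (∀ {x} → x ∈ₗ xs → g x ≤ c) →
              List.foldr (λ x m → g x ⊔ m) 0 xs ≤ c
  foldr-⊔-≤ g []       _     = z≤n
  foldr-⊔-≤ g (x ∷ xs) bound = ⊔-lub (bound (here refl)) (foldr-⊔-≤ g xs (bound ∘ there))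

  ≤-foldr-⊔ : ∀ {X : Set} (g : X → ℕ) {x xs} → x ∈ₗ xs → g x ≤ List.foldr (λ x m → g x ⊔ m) 0 xs
  ≤-foldr-⊔ g (here refl)              = m≤m⊔n _ _
  ≤-foldr-⊔ g {xs = y ∷ xs} (there x∈) = ≤-trans (≤-foldr-⊔ g x∈) (m≤n⊔m (g y) _)

  isSchubertBasis⇒gale : ∀ {n} (S B : Subset n) → isSchubertBasis S B ≡ true → gale 0 B S ≡ true
  isSchubertBasis⇒gale S B basis =
    trans (sym (pointwiseLeq-elements≡gale B S)) (∧-conicalʳ (does (∣ B ∣ ≟ ∣ S ∣)) _ basis)

  gale⇒isSchubertBasis : ∀ {n} (S B : Subset n) → gale 0 B S ≡ true → isSchubertBasis S B ≡ true
  gale⇒isSchubertBasis S B g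
    rewrite dec-true (∣ B ∣ ≟ ∣ S ∣) (trans (sym (+-identityʳ ∣ B ∣)) (gale-∣∣ 0 B S g)) =
    trans (pointwiseLeq-elements≡gale B S) g

  schubertRank≡rankFormula : ∀ {n} (S A : Subset n) → schubertRank S A ≡ rankFormula S A
  schubertRank≡rankFormula {n} S A = ≤-antisym
    (foldr-⊔-≤ (λ B → ∣ A ∩ B ∣) (schubertBases S) λ {B} B∈ →
       gale⇒∣A∩B∣≤rankFormula 0 B S A (isSchubertBasis⇒gale S B (basis B∈)))
    (≤-trans (subst (_≤ ∣ A ∩ B ∣) (m≥n⇒m⊓n≡n (rankFormula≤∣S∣ S A)) r≤)
             (≤-foldr-⊔ (λ B → ∣ A ∩ B ∣)
                (∈-filter⁺ (T? ∘ isSchubertBasis S) (∈-allSubsets B)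
                           (Equivalence.from T-≡ (gale⇒isSchubertBasis S B g)))))
    where
    basis : ∀ {B} → B ∈ₗ schubertBases S → isSchubertBasis S B ≡ true
    basis B∈ = Equivalence.to T-≡ (proj₂ (∈-filter⁻ (T? ∘ isSchubertBasis S) {xs = allSubsets n} B∈))
    witness = ∃-gale-rankFormula 0 S A z≤n
    B = proj₁ witness
    g = proj₁ (proj₂ witness)
    r≤ = proj₂ (proj₂ witness)

  rankFormula-monoˡ : ∀ {n} (S A B : Subset n) → rankFormula S (A ∩ B) ≤ rankFormula S A
  rankFormula-monoˡ []      []      []      = z≤n
  rankFormula-monoˡ (s ∷ S) (a ∷ A) (b ∷ B) =
    ⊓-monoʳ-≤ ∣ s ∷ S ∣ (+-mono-≤ (Bool→ℕ-∧ˡ a b) (rankFormula-monoˡ S A B))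

  rankFormula-monoʳ : ∀ {n} (S A B : Subset n) → rankFormula S (A ∩ B) ≤ rankFormula S B
  rankFormula-monoʳ S A B =
    subst (λ C → rankFormula S C ≤ rankFormula S B) (∩-comm B A) (rankFormula-monoˡ S B A)

  ⊓-truncate-+-≤ : ∀ {u v c p q} → u ≤ c → v ≤ c → v ≤ p → v ≤ q → u + v ≤ p + q → u + v ≤ c ⊓ p + c ⊓ q
  ⊓-truncate-+-≤ {c = c} {p} {q} u≤c v≤c v≤p v≤q u+v≤p+q with ≤-total c p | ≤-total c q
  ... | inj₁ c≤p | inj₁ c≤q rewrite m≤n⇒m⊓n≡m c≤p | m≤n⇒m⊓n≡m c≤q = +-mono-≤ u≤c v≤c
  ... | inj₁ c≤p | inj₂ q≤c rewrite m≤n⇒m⊓n≡m c≤p | m≥n⇒m⊓n≡n q≤c = +-mono-≤ u≤c v≤q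
  ... | inj₂ p≤c | inj₁ c≤q rewrite m≥n⇒m⊓n≡n p≤c | m≤n⇒m⊓n≡m c≤q =
    ≤-trans (+-mono-≤ u≤c v≤p) (≤-reflexive (+-comm c p))
  ... | inj₂ p≤c | inj₂ q≤c rewrite m≥n⇒m⊓n≡n p≤c | m≥n⇒m⊓n≡n q≤c = u+v≤p+q

  rankFormula-submodular : ∀ {n} (S A B : Subset n) →
    rankFormula S (A ∪ B) + rankFormula S (A ∩ B) ≤ rankFormula S A + rankFormula S B
  rankFormula-submodular []      []      []      = z≤n
  rankFormula-submodular (s ∷ S) (a ∷ A) (b ∷ B) =
    ⊓-truncate-+-≤ {c = ∣ s ∷ S ∣} {Bool→ℕ a + rankFormula S A} {Bool→ℕ b + rankFormula S B}
    (m⊓n≤m _ _) (m⊓n≤m _ _)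
    (≤-trans (m⊓n≤n _ _) (+-mono-≤ (Bool→ℕ-∧ˡ a b) (rankFormula-monoˡ S A B)))
    (≤-trans (m⊓n≤n _ _) (+-mono-≤ (subst (λ c → Bool→ℕ c ≤ Bool→ℕ b) (∧-comm b a) (Bool→ℕ-∧ˡ b a))
                                   (rankFormula-monoʳ S A B)))
    (begin
      ∣ s ∷ S ∣ ⊓ (Bool→ℕ (a ∨ b) + rankFormula S (A ∪ B)) +
      ∣ s ∷ S ∣ ⊓ (Bool→ℕ (a ∧ b) + rankFormula S (A ∩ B))
        ≤⟨ +-mono-≤ (m⊓n≤n ∣ s ∷ S ∣ _) (m⊓n≤n ∣ s ∷ S ∣ _) ⟩
      (Bool→ℕ (a ∨ b) + rankFormula S (A ∪ B)) + (Bool→ℕ (a ∧ b) + rankFormula S (A ∩ B))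
        ≡⟨ interchange (Bool→ℕ (a ∨ b)) _ (Bool→ℕ (a ∧ b)) _ ⟩
      (Bool→ℕ (a ∨ b) + Bool→ℕ (a ∧ b)) + (rankFormula S (A ∪ B) + rankFormula S (A ∩ B))
        ≤⟨ +-mono-≤ (≤-reflexive (Bool→ℕ-∨-∧ a b)) (rankFormula-submodular S A B) ⟩
      (Bool→ℕ a + Bool→ℕ b) + (rankFormula S A + rankFormula S B)
        ≡⟨ interchange (Bool→ℕ a) (Bool→ℕ b) _ _ ⟩
      (Bool→ℕ a + rankFormula S A) + (Bool→ℕ b + rankFormula S B) ∎)
    where open ≤-Reasoning

  rankFormula-⊥ : ∀ {n} (S : Subset n) → rankFormula S ⊥ ≡ 0
  rankFormula-⊥ []      = refl
  rankFormula-⊥ (s ∷ S) rewrite rankFormula-⊥ S = ⊓-zeroʳ ∣ s ∷ S ∣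

  rankFormula-⊤ : ∀ {n} (S : Subset n) → rankFormula S ⊤ ≡ ∣ S ∣
  rankFormula-⊤ []            = refl
  rankFormula-⊤ (inside  ∷ S) rewrite rankFormula-⊤ S = cong suc (⊓-idem ∣ S ∣)
  rankFormula-⊤ (outside ∷ S) rewrite rankFormula-⊤ S = m≤n⇒m⊓n≡m (n≤1+n ∣ S ∣)

  schubertRank-submodular : ∀ {n} (S A B : Subset n) →
    schubertRank S (A ∪ B) + schubertRank S (A ∩ B) ≤ schubertRank S A + schubertRank S B
  schubertRank-submodular S A B
    rewrite schubertRank≡rankFormula S (A ∪ B) | schubertRank≡rankFormula S (A ∩ B)
          | schubertRank≡rankFormula S A | schubertRank≡rankFormula S B = rankFormula-submodular S A B

  sum-tabulate-+-≤ : ∀ {n} (g h g′ h′ : Fin n → ℕ) → (∀ j → g j + h j ≤ g′ j + h′ j) →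
                     Vec.sum (tabulate g) + Vec.sum (tabulate h) ≤
                     Vec.sum (tabulate g′) + Vec.sum (tabulate h′)
  sum-tabulate-+-≤ {zero}  g h g′ h′ _  = z≤n
  sum-tabulate-+-≤ {suc n} g h g′ h′ ≤′ = begin
    (g zero + Vec.sum (tabulate (g ∘ suc))) + (h zero + Vec.sum (tabulate (h ∘ suc)))
      ≡⟨ interchange (g zero) _ (h zero) _ ⟩
    (g zero + h zero) + (Vec.sum (tabulate (g ∘ suc)) + Vec.sum (tabulate (h ∘ suc)))
      ≤⟨ +-mono-≤ (≤′ zero) (sum-tabulate-+-≤ (g ∘ suc) (h ∘ suc) (g′ ∘ suc) (h′ ∘ suc) (≤′ ∘ suc)) ⟩
    (g′ zero + h′ zero) + (Vec.sum (tabulate (g′ ∘ suc)) + Vec.sum (tabulate (h′ ∘ suc)))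
      ≡⟨ interchange (g′ zero) (h′ zero) _ _ ⟩
    (g′ zero + Vec.sum (tabulate (g′ ∘ suc))) + (h′ zero + Vec.sum (tabulate (h′ ∘ suc))) ∎
    where open ≤-Reasoning

  sum-tabulate-0 : ∀ {n} (g : Fin n → ℕ) → (∀ j → g j ≡ 0) → Vec.sum (tabulate g) ≡ 0
  sum-tabulate-0 {zero}  g g≡0 = refl
  sum-tabulate-0 {suc n} g g≡0 = cong₂ _+_ (g≡0 zero) (sum-tabulate-0 (g ∘ suc) (g≡0 ∘ suc))

  rankD-submodular : ∀ {n} (D : Diagram n) A B → rankD D (A ∪ B) + rankD D (A ∩ B) ≤ rankD D A + rankD D B
  rankD-submodular D A B = sum-tabulate-+-≤ _ _ _ _ (λ j → schubertRank-submodular (column D j) A B)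

  rankD-⊥ : ∀ {n} (D : Diagram n) → rankD D ⊥ ≡ 0
  rankD-⊥ D = sum-tabulate-0 _ λ j →
    trans (schubertRank≡rankFormula (column D j) ⊥) (rankFormula-⊥ (column D j))

  rankD-⊤ : ∀ {n} (D : Diagram n) → rankD D ⊤ ≡ size D
  rankD-⊤ D = cong Vec.sum (Vec.tabulate-cong λ j →
    trans (schubertRank≡rankFormula (column D j) ⊤) (rankFormula-⊤ (column D j)))

  symbol : Bool → Bool → List Sym
  symbol false true  = opn ∷ []
  symbol true  false = cls ∷ []
  symbol true  true  = star ∷ []
  symbol false false = []

  columnWord : ∀ {n} → Subset n → Subset n → List Sym
  columnWord []      []      = []
  columnWord (d ∷ c) (s ∷ S) = symbol d s ++ columnWord c S

  -- `word` and `matched` recurse through local helpers of Defs that are out of scope here; the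
  -- equation in each block lets unification recover them.  `matchedFrom w l k` reads l with k
  -- unmatched "(" pending.
  mutual
    wordFrom : ∀ {n} → Diagram n → Fin n → Subset n → List (Fin n) → List Sym
    wordFrom D j S = _

    word≡wordFrom : ∀ {n} (D : Diagram n) j S → word D j S ≡ wordFrom D j S (List.allFin n)
    word≡wordFrom {n} D j S with List.allFin n
    ... | is = refl

  mutual
    matchedFrom : List Sym → List Sym → ℕ → ℕ
    matchedFrom w = _

    matched-opn : ∀ w → matched (opn ∷ w) ≡ matchedFrom (opn ∷ w) w 1
    matched-opn w with opn ∷ w | 1
    ... | w′ | k = refl

  wordFrom-∷ : ∀ {n} (D : Diagram n) j S i is →
               wordFrom D j S (i ∷ is) ≡ symbol (D i j) (lookup S i) ++ wordFrom D j S is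
  wordFrom-∷ D j S i is with D i j | lookup S i
  ... | false | true  = refl
  ... | true  | false = refl
  ... | true  | true  = refl
  ... | false | false = refl

  wordFrom-tabulate : ∀ {n m} (D : Diagram n) j S (f : Fin m → Fin n) →
    wordFrom D j S (List.tabulate f) ≡ columnWord (tabulate (λ i → D (f i) j)) (tabulate (lookup S ∘ f))
  wordFrom-tabulate {m = zero}  D j S f = refl
  wordFrom-tabulate {m = suc m} D j S f =
    trans (wordFrom-∷ D j S (f zero) (List.tabulate (f ∘ suc)))
          (cong (symbol (D (f zero) j) (lookup S (f zero)) ++_) (wordFrom-tabulate D j S (f ∘ suc)))

  word≡columnWord : ∀ {n} (D : Diagram n) j S → word D j S ≡ columnWord (column D j) S
  word≡columnWord {n} D j S = trans (word≡wordFrom D j S)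
    (trans (wordFrom-tabulate D j S id) (cong (columnWord (column D j)) (Vec.tabulate∘lookup S)))

  ⊓-+-⊓ : ∀ x k y → x ⊓ (k + x ⊓ y) ≡ x ⊓ (k + y)
  ⊓-+-⊓ x k y = begin
    x ⊓ (k + x ⊓ y)         ≡⟨ cong (x ⊓_) (+-distribˡ-⊓ k x y) ⟩
    x ⊓ ((k + x) ⊓ (k + y)) ≡⟨ ⊓-assoc x (k + x) (k + y) ⟨
    (x ⊓ (k + x)) ⊓ (k + y) ≡⟨ cong (_⊓ (k + y)) (m≤n⇒m⊓n≡m (m≤n+m x k)) ⟩
    x ⊓ (k + y)             ∎
    where open ≡-Reasoning

  matchedFrom-columnWord : ∀ {n} w (c A : Subset n) k →
    matchedFrom w (columnWord c A) k + stars (columnWord c A) ≡ ∣ c ∣ ⊓ (k + rankFormula c A)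
  matchedFrom-columnWord w []            []            k = refl
  matchedFrom-columnWord w (outside ∷ c) (inside  ∷ A) k = begin
    matchedFrom w (columnWord c A) (suc k) + stars (columnWord c A)
      ≡⟨ matchedFrom-columnWord w c A (suc k) ⟩
    ∣ c ∣ ⊓ (suc k + rankFormula c A)            ≡⟨ cong (∣ c ∣ ⊓_) (+-suc k _) ⟨
    ∣ c ∣ ⊓ (k + suc (rankFormula c A))          ≡⟨ ⊓-+-⊓ ∣ c ∣ k _ ⟨
    ∣ c ∣ ⊓ (k + ∣ c ∣ ⊓ suc (rankFormula c A))  ∎
    where open ≡-Reasoning
  matchedFrom-columnWord w (inside  ∷ c) (outside ∷ A) zero    = begin
    matchedFrom w (columnWord c A) 0 + stars (columnWord c A) ≡⟨ matchedFrom-columnWord w c A 0 ⟩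
    ∣ c ∣ ⊓ rankFormula c A                                  ≡⟨ m≥n⇒m⊓n≡n r≤∣c∣ ⟩
    rankFormula c A                                          ≡⟨ m≥n⇒m⊓n≡n (m≤n⇒m≤1+n r≤∣c∣) ⟨
    suc ∣ c ∣ ⊓ rankFormula c A                              ≡⟨ m≥n⇒m⊓n≡n (m⊓n≤m (suc ∣ c ∣) _) ⟨
    suc ∣ c ∣ ⊓ (suc ∣ c ∣ ⊓ rankFormula c A)                ∎
    where
    open ≡-Reasoning
    r≤∣c∣ = rankFormula≤∣S∣ c A
  matchedFrom-columnWord w (inside  ∷ c) (outside ∷ A) (suc k) = begin
    suc (matchedFrom w (columnWord c A) k + stars (columnWord c A))
      ≡⟨ cong suc (matchedFrom-columnWord w c A k) ⟩
    suc (∣ c ∣ ⊓ (k + rankFormula c A))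
      ≡⟨ cong (λ r → suc ∣ c ∣ ⊓ (suc k + r)) (m≥n⇒m⊓n≡n (m≤n⇒m≤1+n (rankFormula≤∣S∣ c A))) ⟨
    suc ∣ c ∣ ⊓ (suc k + suc ∣ c ∣ ⊓ rankFormula c A)               ∎
    where open ≡-Reasoning
  matchedFrom-columnWord w (inside  ∷ c) (inside  ∷ A) k = begin
    matchedFrom w (columnWord c A) k + suc (stars (columnWord c A)) ≡⟨ +-suc _ _ ⟩
    suc (matchedFrom w (columnWord c A) k + stars (columnWord c A))
      ≡⟨ cong suc (matchedFrom-columnWord w c A k) ⟩
    suc (∣ c ∣ ⊓ (k + rankFormula c A))
      ≡⟨ cong (suc ∣ c ∣ ⊓_) (+-suc k _) ⟨
    suc ∣ c ∣ ⊓ (k + suc (rankFormula c A))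
      ≡⟨ cong (λ r → suc ∣ c ∣ ⊓ (k + suc r)) (m≥n⇒m⊓n≡n (rankFormula≤∣S∣ c A)) ⟨
    suc ∣ c ∣ ⊓ (k + suc ∣ c ∣ ⊓ suc (rankFormula c A))             ∎
    where open ≡-Reasoning
  matchedFrom-columnWord w (outside ∷ c) (outside ∷ A) k =
    trans (matchedFrom-columnWord w c A k) (sym (⊓-+-⊓ ∣ c ∣ k _))

  θ-column≡schubertRank : ∀ {n} (D : Diagram n) j S →
    matched (word D j S) + stars (word D j S) ≡ schubertRank (column D j) S
  θ-column≡schubertRank D j S = begin
    matched (word D j S) + stars (word D j S)
      ≡⟨ cong (λ w → matched w + stars w) (word≡columnWord D j S) ⟩
    matched (columnWord c S) + stars (columnWord c S)
      ≡⟨ matchedFrom-columnWord (columnWord c S) c S 0 ⟩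
    ∣ c ∣ ⊓ rankFormula c S                            ≡⟨ m≥n⇒m⊓n≡n (rankFormula≤∣S∣ c S) ⟩
    rankFormula c S                                    ≡⟨ schubertRank≡rankFormula c S ⟨
    schubertRank c S                                   ∎
    where
    open ≡-Reasoning
    c = column D j

  θ≡rankD : ∀ {n} (D : Diagram n) S → θ D S ≡ rankD D S
  θ≡rankD D S = cong Vec.sum (Vec.tabulate-cong λ j → θ-column≡schubertRank D j S)

open Polytopes using (ℕ→ℚ-+; ℕ→ℚ-mono-≤; Extreme-cong; module BasePolytope)
open SchubertMatroid using (rankD-⊥; rankD-⊤; rankD-submodular; θ≡rankD)

theorem3p2 : (n : ℕ) (D : Diagram n) (x : Point n) →
    (IsVertex D x → ∃[ w ] (∀ i → x i ≡ xOf D w i)) ×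
    ((w : Permutation′ n) → IsVertex D (xOf D w))
theorem3p2 n D x =
  extreme⇒greedy ∘ Extreme-cong schubitope⇔base ,
  Extreme-cong (⇔.sym ∘ schubitope⇔base) ∘ greedy-extreme
  where
  r : Subset n → ℚ
  r S = ℕ→ℚ (rankD D S)
  r-submodular : ∀ A B → r (A ∪ B) ℚ.+ r (A ∩ B) ℚ.≤ r A ℚ.+ r B
  r-submodular A B =
    subst₂ ℚ._≤_ (ℕ→ℚ-+ (rankD D (A ∪ B)) (rankD D (A ∩ B))) (ℕ→ℚ-+ (rankD D A) (rankD D B))
                 (ℕ→ℚ-mono-≤ (rankD-submodular D A B))
  open BasePolytope r (cong ℕ→ℚ (rankD-⊥ D)) r-submodular
  schubitope⇔base : ∀ y → InSchubitope D y ⇔ InBase y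
  schubitope⇔base y = mk⇔
    (λ (y⊤ , y≤) → trans y⊤ (cong ℕ→ℚ (sym (rankD-⊤ D))) ,
                   λ S S≢⊤ → subst (_ ℚ.≤_) (cong ℕ→ℚ (θ≡rankD D S)) (y≤ S S≢⊤))
    (λ (y⊤ , y≤) → trans y⊤ (cong ℕ→ℚ (rankD-⊤ D)) ,
                   λ S S≢⊤ → subst (_ ℚ.≤_) (cong ℕ→ℚ (sym (θ≡rankD D S))) (y≤ S S≢⊤))
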